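{- Let $|q|<1$. Then \[ \sum_{n\geq 0} \frac{q^{2n^2+2n}(-q^3;q^6)_n}{(q^2;q^2)_{2n}(-q;q^2)_n}=\frac{1}{(q^2;q^2)_\infty}\sum_{n\geq 0} (-1)^n q^{n(n+1)}\sum_{j=-\lfloor \frac{n}{2}\rfloor}^{\lfloor \frac{n}{2}\rfloor} e^{\frac{2\pi ij}{3}}q^{ -j^2}. \]
   Context: $(a;q)_n=\prod_{k=0}^{n-1}(1-aq^k)$, $(a;q)_\infty=\prod_{k\ge0}(1-aq^k)$. -}

module Defs where

open import Data.Nat as ℕ using (ℕ; zero; suc; _∸_)
open import Data.Integer as ℤ using (ℤ)
open import Data.Integer.DivMod using (_%ℕ_)
open import Data.List as List using (List)
open import Data.Fin using (Fin; toℕ)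
open import Data.Vec as Vec using (Vec; _∷_)

-- The ring ℤ[ω], ω = e^{2πi/3} (so ω² = -1 - ω); element  re + im·ω.

record ℤω : Set where
  constructor mkω
  field
    re : ℤ
    im : ℤ

0ω 1ω ω : ℤω
0ω = mkω (ℤ.+ 0) (ℤ.+ 0)
1ω = mkω (ℤ.+ 1) (ℤ.+ 0)
ω  = mkω (ℤ.+ 0) (ℤ.+ 1)

_+ω_ : ℤω → ℤω → ℤω
mkω a b +ω mkω c d = mkω (a ℤ.+ c) (b ℤ.+ d)

-ω_ : ℤω → ℤω
-ω mkω a b = mkω (ℤ.- a) (ℤ.- b)

-- (a + bω)(c + dω) = ac + (ad + bc)ω + bd ω² = (ac - bd) + (ad + bc - bd)ω
_*ω_ : ℤω → ℤω → ℤω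
mkω a b *ω mkω c d = mkω (a ℤ.* c ℤ.- b ℤ.* d) (a ℤ.* d ℤ.+ b ℤ.* c ℤ.- b ℤ.* d)

-- e^{2πij/3} = ω^j for j ∈ ℤ, depending only on j mod 3
expOmega : ℤ → ℤω
expOmega j with j %ℕ 3
... | 0 = 1ω
... | 1 = ω
... | _ = mkω (ℤ.- ℤ.+ 1) (ℤ.- ℤ.+ 1)

PS : Set
PS = ℕ → ℤω

sumTo : (ℕ → ℤω) → ℕ → ℤω
sumTo f zero    = 0ω
sumTo f (suc n) = sumTo f n +ω f n

const : ℤω → PS
const c zero    = c
const c (suc _) = 0ω

one : PS
one = const 1ω

X : PS
X (suc zero) = 1ω
X _          = 0ω

_⊕_ : PS → PS → PS
(f ⊕ g) N = f N +ω g N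

neg : PS → PS
neg f N = -ω f N

_⊖_ : PS → PS → PS
f ⊖ g = f ⊕ neg g

_⊛_ : PS → PS → PS
(f ⊛ g) N = sumTo (λ i → f i *ω g (N ∸ i)) (suc N)

pow : PS → ℕ → PS
pow f zero    = one
pow f (suc k) = pow f k ⊛ f

sumPS : List PS → PS
sumPS = List.foldr _⊕_ (const 0ω)

-- multiplicative inverse of a series with constant term 1:
-- g 0 = 1, g N = - Σ_{i=1}^{N} f i · g (N - i).
-- invVec f N = [g N, g (N-1), …, g 0]
sumFin : (n : ℕ) → (Fin n → ℤω) → ℤω
sumFin n h = Vec.foldr (λ _ → ℤω) _+ω_ 0ω (Vec.tabulate h)

invVec : PS → (N : ℕ) → Vec ℤω (suc N)
invVec f zero    = 1ω ∷ Vec.[]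
invVec f (suc N) =
  (-ω sumFin (suc N) (λ i → f (suc (toℕ i)) *ω Vec.lookup (invVec f N) i))
  ∷ invVec f N

inv : PS → PS
inv f N = Vec.head (invVec f N)

_⊘_ : PS → PS → PS
f ⊘ g = f ⊛ inv g

qPoch : PS → PS → ℕ → PS
qPoch a q zero    = one
qPoch a q (suc n) = qPoch a q n ⊛ (one ⊖ (a ⊛ pow q n))

-- (a;q)_∞ for a, q of positive order: a q^k has order ≥ k+1, so the
-- coefficient of q^N is already that of (a;q)_N.
qPochInf : PS → PS → PS
qPochInf a q N = qPoch a q N N

-- Σ_{n≥0} F n, for families where F n has order ≥ n: the coefficient of
-- q^N only receives contributions from n ≤ N.
sumSeries : (ℕ → PS) → PS
sumSeries F N = sumTo (λ n → F n N) (suc N)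

lhsTerm : ℕ → PS
lhsTerm n =
  (pow X (2 ℕ.* n ℕ.* n ℕ.+ 2 ℕ.* n) ⊛ qPoch (neg (pow X 3)) (pow X 6) n)
  ⊘ (qPoch (pow X 2) (pow X 2) (2 ℕ.* n) ⊛ qPoch (neg X) (pow X 2) n)

LHS : PS
LHS = sumSeries lhsTerm

jRange : ℕ → List ℤ
jRange n = List.map (λ k → ℤ.+ k ℤ.- ℤ.+ m) (List.upTo (suc (2 ℕ.* m)))
  where m = n ℕ./ 2

-- Σ_j e^{2πij/3} q^{n(n+1)} q^{-j²}  (the exponent n(n+1) - j² is ≥ 0 here)
innerTerm : ℕ → PS
innerTerm n = sumPS (List.map (λ j → const (expOmega j)
                     ⊛ pow X (n ℕ.* suc n ∸ ℤ.∣ j ∣ ℕ.* ℤ.∣ j ∣)) (jRange n))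

rhsTerm : ℕ → PS
rhsTerm n = pow (neg one) n ⊛ innerTerm n

RHS : PS
RHS = inv (qPochInf (pow X 2) (pow X 2)) ⊛ sumSeries rhsTerm

-- Over the cube roots of unity, 1 + q^{6k+3} = (1 + y)(1 + ωy)(1 + ω²y) with y = q^{2k+1}, so the
-- n-th summand on the left is q^{2n²+2n} (-ωq;q²)_n (-ω²q;q²)_n / (q²;q²)_{2n}.  Up to ω^n q^{3n²},
-- the numerator is ∏_{k<2n} (q^{2n} + ω q^{2k+1}); expanding it by the q-binomial theorem and pairing
-- the indices n ± j turns the left-hand side into
--   Σ_j (ω^j + ω^{-j}) q^{3j²+2j} Σ_m q^{2m(m+1+2j)} / ((q²;q²)_m (q²;q²)_{m+2j}).
-- After multiplication by (q²;q²)_∞, Euler's expansion of (q²;q²)_∞ / (q²;q²)_{m+2j} and an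
-- alternating q-binomial sum collapse each inner sum to Σ_r (-1)^r q^{r²+r+4jr}.  On the right,
-- grouping ±j and writing n = 2j + r gives the same double sum.  Series are formal power series
-- over ℤ[ω] compared coefficientwise, and infinite sums are compared through their truncations.

module Submission where

open import Defs
open import Level using (0ℓ)
open import Data.Nat as ℕ using (ℕ; zero; suc; _+_; _*_; _∸_; _%_; _≤_; _<_; z≤n; s≤s)
import Data.Nat.Properties as ℕP
open import Data.Nat.DivMod using (_/_; n/1≡n; m/n*n≤m; m*n/n≡m; /-monoˡ-≤; m/n≤m; m≡m%n+[m/n]*n; m%n<n)
open import Data.Nat.Tactic.RingSolver using (solve-∀)
open import Data.Integer as ℤ using (ℤ; +_; -[1+_])
import Data.Integer.Properties as ℤP
import Data.Integer.Tactic.RingSolver as ℤ-Solver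
open import Data.Product using (_,_)
open import Data.Empty using (⊥-elim)
import Data.List as List
open import Relation.Nullary using (yes; no)
open import Relation.Binary.PropositionalEquality
open import Relation.Binary.Bundles using (Setoid)
open import Algebra.Bundles using (CommutativeRing)
import Relation.Binary.Reasoning.Setoid

+ω-comm : ∀ x y → x +ω y ≡ y +ω x
+ω-comm (mkω a b) (mkω c d) = cong₂ mkω (ℤP.+-comm a c) (ℤP.+-comm b d)

+ω-assoc : ∀ x y z → (x +ω y) +ω z ≡ x +ω (y +ω z)
+ω-assoc (mkω a b) (mkω c d) (mkω e f) = cong₂ mkω (ℤP.+-assoc a c e) (ℤP.+-assoc b d f)

+ω-identityʳ : ∀ x → x +ω 0ω ≡ x
+ω-identityʳ (mkω a b) = cong₂ mkω (ℤP.+-identityʳ a) (ℤP.+-identityʳ b)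

+ω-identityˡ : ∀ x → 0ω +ω x ≡ x
+ω-identityˡ x = trans (+ω-comm 0ω x) (+ω-identityʳ x)

+ω-inverseʳ : ∀ x → x +ω (-ω x) ≡ 0ω
+ω-inverseʳ (mkω a b) = cong₂ mkω (ℤP.+-inverseʳ a) (ℤP.+-inverseʳ b)

-ω-distrib-+ω : ∀ x y → -ω (x +ω y) ≡ (-ω x) +ω (-ω y)
-ω-distrib-+ω (mkω a b) (mkω c d) = cong₂ mkω (ℤP.neg-distrib-+ a c) (ℤP.neg-distrib-+ b d)

+ω-interchange : ∀ a b c d → (a +ω b) +ω (c +ω d) ≡ (a +ω c) +ω (b +ω d)
+ω-interchange a b c d = begin
  (a +ω b) +ω (c +ω d) ≡⟨ +ω-assoc a b (c +ω d) ⟩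
  a +ω (b +ω (c +ω d)) ≡⟨ cong (a +ω_) (sym (+ω-assoc b c d)) ⟩
  a +ω ((b +ω c) +ω d) ≡⟨ cong (λ t → a +ω (t +ω d)) (+ω-comm b c) ⟩
  a +ω ((c +ω b) +ω d) ≡⟨ cong (a +ω_) (+ω-assoc c b d) ⟩
  a +ω (c +ω (b +ω d)) ≡⟨ sym (+ω-assoc a c (b +ω d)) ⟩
  (a +ω c) +ω (b +ω d) ∎
  where open ≡-Reasoning

*ω-comm : ∀ x y → x *ω y ≡ y *ω x
*ω-comm (mkω a b) (mkω c d) = cong₂ mkω (re a b c d) (im a b c d)
  where
  re : ∀ a b c d → a ℤ.* c ℤ.- b ℤ.* d ≡ c ℤ.* a ℤ.- d ℤ.* b
  re = ℤ-Solver.solve-∀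
  im : ∀ a b c d → a ℤ.* d ℤ.+ b ℤ.* c ℤ.- b ℤ.* d ≡ c ℤ.* b ℤ.+ d ℤ.* a ℤ.- d ℤ.* b
  im = ℤ-Solver.solve-∀

*ω-assoc : ∀ x y z → (x *ω y) *ω z ≡ x *ω (y *ω z)
*ω-assoc (mkω a b) (mkω c d) (mkω e f) = cong₂ mkω (re a b c d e f) (im a b c d e f)
  where
  re : ∀ a b c d e f → (a ℤ.* c ℤ.- b ℤ.* d) ℤ.* e ℤ.- (a ℤ.* d ℤ.+ b ℤ.* c ℤ.- b ℤ.* d) ℤ.* f
                     ≡ a ℤ.* (c ℤ.* e ℤ.- d ℤ.* f) ℤ.- b ℤ.* (c ℤ.* f ℤ.+ d ℤ.* e ℤ.- d ℤ.* f)
  re = ℤ-Solver.solve-∀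
  im : ∀ a b c d e f → (a ℤ.* c ℤ.- b ℤ.* d) ℤ.* f ℤ.+ (a ℤ.* d ℤ.+ b ℤ.* c ℤ.- b ℤ.* d) ℤ.* e ℤ.- (a ℤ.* d ℤ.+ b ℤ.* c ℤ.- b ℤ.* d) ℤ.* f
                     ≡ a ℤ.* (c ℤ.* f ℤ.+ d ℤ.* e ℤ.- d ℤ.* f) ℤ.+ b ℤ.* (c ℤ.* e ℤ.- d ℤ.* f) ℤ.- b ℤ.* (c ℤ.* f ℤ.+ d ℤ.* e ℤ.- d ℤ.* f)
  im = ℤ-Solver.solve-∀

*ω-distribˡ-+ω : ∀ x y z → x *ω (y +ω z) ≡ (x *ω y) +ω (x *ω z)
*ω-distribˡ-+ω (mkω a b) (mkω c d) (mkω e f) = cong₂ mkω (re a b c d e f) (im a b c d e f)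
  where
  re : ∀ a b c d e f → a ℤ.* (c ℤ.+ e) ℤ.- b ℤ.* (d ℤ.+ f) ≡ (a ℤ.* c ℤ.- b ℤ.* d) ℤ.+ (a ℤ.* e ℤ.- b ℤ.* f)
  re = ℤ-Solver.solve-∀
  im : ∀ a b c d e f → a ℤ.* (d ℤ.+ f) ℤ.+ b ℤ.* (c ℤ.+ e) ℤ.- b ℤ.* (d ℤ.+ f) ≡ (a ℤ.* d ℤ.+ b ℤ.* c ℤ.- b ℤ.* d) ℤ.+ (a ℤ.* f ℤ.+ b ℤ.* e ℤ.- b ℤ.* f)
  im = ℤ-Solver.solve-∀

*ω-identityʳ : ∀ x → x *ω 1ω ≡ x
*ω-identityʳ (mkω a b) = cong₂ mkω (re a b) (im a b)
  where
  re : ∀ a b → a ℤ.* + 1 ℤ.- b ℤ.* + 0 ≡ a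
  re = ℤ-Solver.solve-∀
  im : ∀ a b → a ℤ.* + 0 ℤ.+ b ℤ.* + 1 ℤ.- b ℤ.* + 0 ≡ b
  im = ℤ-Solver.solve-∀

*ω-zeroʳ : ∀ x → x *ω 0ω ≡ 0ω
*ω-zeroʳ (mkω a b) = cong₂ mkω (re a b) (im a b)
  where
  re : ∀ a b → a ℤ.* + 0 ℤ.- b ℤ.* + 0 ≡ + 0
  re = ℤ-Solver.solve-∀
  im : ∀ a b → a ℤ.* + 0 ℤ.+ b ℤ.* + 0 ℤ.- b ℤ.* + 0 ≡ + 0
  im = ℤ-Solver.solve-∀

*ω-identityˡ : ∀ x → 1ω *ω x ≡ x
*ω-identityˡ x = trans (*ω-comm 1ω x) (*ω-identityʳ x)

*ω-zeroˡ : ∀ x → 0ω *ω x ≡ 0ω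
*ω-zeroˡ x = trans (*ω-comm 0ω x) (*ω-zeroʳ x)

sumTo-cong : ∀ {f g} n → (∀ i → i < n → f i ≡ g i) → sumTo f n ≡ sumTo g n
sumTo-cong zero    f≡g = refl
sumTo-cong (suc n) f≡g = cong₂ _+ω_ (sumTo-cong n (λ i i<n → f≡g i (ℕP.m≤n⇒m≤1+n i<n))) (f≡g n ℕP.≤-refl)

sumTo-zero : ∀ {f} n → (∀ i → i < n → f i ≡ 0ω) → sumTo f n ≡ 0ω
sumTo-zero n f≡0 = trans (sumTo-cong n f≡0) (sumTo-const0 n)
  where
  sumTo-const0 : ∀ n → sumTo (λ _ → 0ω) n ≡ 0ω
  sumTo-const0 zero    = refl
  sumTo-const0 (suc n) = trans (cong (_+ω 0ω) (sumTo-const0 n)) (+ω-identityʳ 0ω)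

sumTo-+ω : ∀ f g n → sumTo (λ i → f i +ω g i) n ≡ sumTo f n +ω sumTo g n
sumTo-+ω f g zero    = sym (+ω-identityʳ 0ω)
sumTo-+ω f g (suc n) =
  trans (cong (_+ω (f n +ω g n)) (sumTo-+ω f g n)) (+ω-interchange (sumTo f n) (sumTo g n) (f n) (g n))

*ω-distribˡ-sumTo : ∀ c f n → c *ω sumTo f n ≡ sumTo (λ i → c *ω f i) n
*ω-distribˡ-sumTo c f zero    = *ω-zeroʳ c
*ω-distribˡ-sumTo c f (suc n) =
  trans (*ω-distribˡ-+ω c (sumTo f n) (f n)) (cong (_+ω (c *ω f n)) (*ω-distribˡ-sumTo c f n))

*ω-distribʳ-sumTo : ∀ c f n → sumTo f n *ω c ≡ sumTo (λ i → f i *ω c) n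
*ω-distribʳ-sumTo c f n =
  trans (*ω-comm _ c) (trans (*ω-distribˡ-sumTo c f n) (sumTo-cong n (λ i _ → *ω-comm c (f i))))

-ω-sumTo : ∀ f n → -ω sumTo f n ≡ sumTo (λ i → -ω f i) n
-ω-sumTo f zero    = refl
-ω-sumTo f (suc n) = trans (-ω-distrib-+ω (sumTo f n) (f n)) (cong (_+ω (-ω f n)) (-ω-sumTo f n))

sumTo-head : ∀ f n → sumTo f (suc n) ≡ f 0 +ω sumTo (λ i → f (suc i)) n
sumTo-head f zero    = trans (+ω-identityˡ (f 0)) (sym (+ω-identityʳ (f 0)))
sumTo-head f (suc n) =
  trans (cong (_+ω f (suc n)) (sumTo-head f n)) (+ω-assoc (f 0) (sumTo (λ i → f (suc i)) n) (f (suc n)))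

sumTo-split : ∀ f a k → sumTo f (a + k) ≡ sumTo f a +ω sumTo (λ b → f (a + b)) k
sumTo-split f a zero    = trans (cong (sumTo f) (ℕP.+-identityʳ a)) (sym (+ω-identityʳ _))
sumTo-split f a (suc k) = begin
  sumTo f (a + suc k)                                    ≡⟨ cong (sumTo f) (ℕP.+-suc a k) ⟩
  sumTo f (a + k) +ω f (a + k)                           ≡⟨ cong (_+ω f (a + k)) (sumTo-split f a k) ⟩
  (sumTo f a +ω sumTo (λ b → f (a + b)) k) +ω f (a + k)  ≡⟨ +ω-assoc (sumTo f a) _ (f (a + k)) ⟩
  sumTo f a +ω sumTo (λ b → f (a + b)) (suc k)           ∎
  where open ≡-Reasoning

sumTo-reverse : ∀ f n → sumTo f n ≡ sumTo (λ i → f (n ∸ suc i)) n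
sumTo-reverse f zero    = refl
sumTo-reverse f (suc n) = begin
  sumTo f n +ω f n                      ≡⟨ +ω-comm (sumTo f n) (f n) ⟩
  f n +ω sumTo f n                      ≡⟨ cong (f n +ω_) (sumTo-reverse f n) ⟩
  f n +ω sumTo (λ i → f (n ∸ suc i)) n  ≡⟨ sym (sumTo-head (λ i → f (suc n ∸ suc i)) n) ⟩
  sumTo (λ i → f (suc n ∸ suc i)) (suc n) ∎
  where open ≡-Reasoning

sumTo-comm : ∀ (F : ℕ → ℕ → ℤω) n m →
             sumTo (λ i → sumTo (F i) m) n ≡ sumTo (λ j → sumTo (λ i → F i j) n) m
sumTo-comm F zero    m = sym (sumTo-zero m (λ _ _ → refl))
sumTo-comm F (suc n) m = trans (cong (_+ω sumTo (F n) m) (sumTo-comm F n m))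
                               (sym (sumTo-+ω (λ j → sumTo (λ i → F i j) n) (F n) m))

when≤ : ℕ → ℕ → ℤω → ℤω
when≤ a i x with a ℕ.≤? i
... | yes _ = x
... | no  _ = 0ω

when≤-yes : ∀ {a i} x → a ≤ i → when≤ a i x ≡ x
when≤-yes {a} {i} x a≤i with a ℕ.≤? i
... | yes _  = refl
... | no a≰i = ⊥-elim (a≰i a≤i)

when≤-no : ∀ {a i} x → i < a → when≤ a i x ≡ 0ω
when≤-no {a} {i} x i<a with a ℕ.≤? i
... | yes a≤i = ⊥-elim (ℕP.<⇒≱ i<a a≤i)
... | no  _   = refl

sumTo-when≤-shift : ∀ a k (f : ℕ → ℤω) → sumTo (λ i → when≤ a i (f i)) (a + k) ≡ sumTo (λ b → f (a + b)) k
sumTo-when≤-shift a k f = begin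
  sumTo (λ i → when≤ a i (f i)) (a + k)
    ≡⟨ sumTo-split _ a k ⟩
  sumTo (λ i → when≤ a i (f i)) a +ω sumTo (λ b → when≤ a (a + b) (f (a + b))) k
    ≡⟨ cong₂ _+ω_ (sumTo-zero a (λ i i<a → when≤-no _ i<a))
                  (sumTo-cong k (λ b _ → when≤-yes _ (ℕP.m≤m+n a b))) ⟩
  0ω +ω sumTo (λ b → f (a + b)) k
    ≡⟨ +ω-identityˡ _ ⟩
  sumTo (λ b → f (a + b)) k ∎
  where open ≡-Reasoning

sumTo-when≤-upTo : ∀ i k (f : ℕ → ℤω) → sumTo (λ a → when≤ a i (f a)) (suc i + k) ≡ sumTo f (suc i)
sumTo-when≤-upTo i k f = begin
  sumTo (λ a → when≤ a i (f a)) (suc i + k)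
    ≡⟨ sumTo-split (λ a → when≤ a i (f a)) (suc i) k ⟩
  sumTo (λ a → when≤ a i (f a)) (suc i) +ω sumTo (λ b → when≤ (suc i + b) i (f (suc i + b))) k
    ≡⟨ cong₂ _+ω_ (sumTo-cong (suc i) (λ a a≤i → when≤-yes (f a) (ℕP.≤-pred a≤i)))
                  (sumTo-zero k (λ b _ → when≤-no (f (suc i + b)) (s≤s (ℕP.m≤m+n i b)))) ⟩
  sumTo f (suc i) +ω 0ω
    ≡⟨ +ω-identityʳ (sumTo f (suc i)) ⟩
  sumTo f (suc i) ∎
  where open ≡-Reasoning

sumTo-when≤-from : ∀ a N (f : ℕ → ℤω) → a ≤ N → sumTo (λ i → when≤ a i (f i)) (suc N) ≡ sumTo (λ b → f (a + b)) (suc (N ∸ a))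
sumTo-when≤-from a N f a≤N = begin
  sumTo (λ i → when≤ a i (f i)) (suc N)             ≡⟨ cong (sumTo _) (sym (ℕP.m+[n∸m]≡n (ℕP.m≤n⇒m≤1+n a≤N))) ⟩
  sumTo (λ i → when≤ a i (f i)) (a + (suc N ∸ a))   ≡⟨ sumTo-when≤-shift a (suc N ∸ a) f ⟩
  sumTo (λ b → f (a + b)) (suc N ∸ a)               ≡⟨ cong (sumTo (λ b → f (a + b))) (ℕP.+-∸-assoc 1 a≤N) ⟩
  sumTo (λ b → f (a + b)) (suc (N ∸ a))             ∎
  where open ≡-Reasoning

infix 4 _≈_ _≈[_]_

record _≈_ (f g : PS) : Set where
  constructor coeffwise
  field coeff : ∀ N → f N ≡ g N
open _≈_ public

record _≈[_]_ (f : PS) (K : ℕ) (g : PS) : Set where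
  constructor coeffwise<
  field coeff< : ∀ N → N < K → f N ≡ g N
open _≈[_]_ public

≈-refl : ∀ {f} → f ≈ f
≈-refl = coeffwise λ _ → refl

≈-sym : ∀ {f g} → f ≈ g → g ≈ f
≈-sym f≈g = coeffwise λ N → sym (coeff f≈g N)

≈-trans : ∀ {f g h} → f ≈ g → g ≈ h → f ≈ h
≈-trans f≈g g≈h = coeffwise λ N → trans (coeff f≈g N) (coeff g≈h N)

≈-setoid : Setoid 0ℓ 0ℓ
≈-setoid = record { Carrier = PS ; _≈_ = _≈_
                  ; isEquivalence = record { refl = ≈-refl ; sym = ≈-sym ; trans = ≈-trans } }

≈[]-refl : ∀ {f} {K} → f ≈[ K ] f
≈[]-refl = coeffwise< λ _ _ → refl

≈[]-setoid : ℕ → Setoid 0ℓ 0ℓ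
≈[]-setoid K = record
  { Carrier = PS ; _≈_ = _≈[ K ]_
  ; isEquivalence = record
    { refl  = ≈[]-refl
    ; sym   = λ f≈g → coeffwise< λ N N<K → sym (coeff< f≈g N N<K)
    ; trans = λ f≈g g≈h → coeffwise< λ N N<K → trans (coeff< f≈g N N<K) (coeff< g≈h N N<K) } }

module ≈[]-Reasoning (K : ℕ) = Relation.Binary.Reasoning.Setoid (≈[]-setoid K)

≈⇒≈[] : ∀ {f g} K → f ≈ g → f ≈[ K ] g
≈⇒≈[] K f≈g = coeffwise< λ N _ → coeff f≈g N

≈[]-all⇒≈ : ∀ {f g} → (∀ K → f ≈[ K ] g) → f ≈ g
≈[]-all⇒≈ f≈g = coeffwise λ N → coeff< (f≈g (suc N)) N ℕP.≤-refl

≈[]-mono : ∀ {f g} {K L} → L ≤ K → f ≈[ K ] g → f ≈[ L ] g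
≈[]-mono L≤K f≈g = coeffwise< λ N N<L → coeff< f≈g N (ℕP.<-≤-trans N<L L≤K)

⊛-cong-≈[] : ∀ {f f′ g g′} K → f ≈[ K ] f′ → g ≈[ K ] g′ → f ⊛ g ≈[ K ] f′ ⊛ g′
⊛-cong-≈[] K f≈f′ g≈g′ = coeffwise< λ N N<K → sumTo-cong (suc N) λ i i≤N →
  cong₂ _*ω_ (coeff< f≈f′ i (ℕP.<-≤-trans i≤N N<K))
             (coeff< g≈g′ (N ∸ i) (ℕP.≤-<-trans (ℕP.m∸n≤m N i) N<K))

⊛-cong : ∀ {f f′ g g′} → f ≈ f′ → g ≈ g′ → f ⊛ g ≈ f′ ⊛ g′
⊛-cong f≈f′ g≈g′ = ≈[]-all⇒≈ λ K → ⊛-cong-≈[] K (≈⇒≈[] K f≈f′) (≈⇒≈[] K g≈g′)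

const-⊛ : ∀ c f N → (const c ⊛ f) N ≡ c *ω f N
const-⊛ c f N = begin
  sumTo (λ i → const c i *ω f (N ∸ i)) (suc N)          ≡⟨ sumTo-head (λ i → const c i *ω f (N ∸ i)) N ⟩
  (c *ω f N) +ω sumTo (λ i → 0ω *ω f (N ∸ suc i)) N    ≡⟨ cong ((c *ω f N) +ω_) (sumTo-zero N (λ i _ → *ω-zeroˡ (f (N ∸ suc i)))) ⟩
  (c *ω f N) +ω 0ω                                      ≡⟨ +ω-identityʳ (c *ω f N) ⟩
  c *ω f N                                              ∎
  where open ≡-Reasoning

⊛-identityˡ : ∀ f → one ⊛ f ≈ f
⊛-identityˡ f = coeffwise λ N → trans (const-⊛ 1ω f N) (*ω-identityˡ (f N))

⊛-comm : ∀ f g → f ⊛ g ≈ g ⊛ f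
⊛-comm f g = coeffwise λ N → begin
  sumTo (λ i → f i *ω g (N ∸ i)) (suc N)              ≡⟨ sumTo-reverse (λ i → f i *ω g (N ∸ i)) (suc N) ⟩
  sumTo (λ i → f (N ∸ i) *ω g (N ∸ (N ∸ i))) (suc N)  ≡⟨ sumTo-cong (suc N) (λ i i≤N →
      trans (cong (λ t → f (N ∸ i) *ω g t) (ℕP.m∸[m∸n]≡n (ℕP.≤-pred i≤N))) (*ω-comm (f (N ∸ i)) (g i))) ⟩
  sumTo (λ i → g i *ω f (N ∸ i)) (suc N)              ∎
  where open ≡-Reasoning

⊛-distribˡ-⊕ : ∀ f g h → f ⊛ (g ⊕ h) ≈ (f ⊛ g) ⊕ (f ⊛ h)
⊛-distribˡ-⊕ f g h = coeffwise λ N →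
  trans (sumTo-cong (suc N) (λ i _ → *ω-distribˡ-+ω (f i) (g (N ∸ i)) (h (N ∸ i))))
        (sumTo-+ω (λ i → f i *ω g (N ∸ i)) (λ i → f i *ω h (N ∸ i)) (suc N))

-- The coefficient of q^N in (f g) h, a sum over a ≤ i ≤ N, is rewritten as a double sum over
-- a, i ≤ N with the condition a ≤ i moved into the summand, and then summed over i first.
⊛-assoc : ∀ f g h → (f ⊛ g) ⊛ h ≈ f ⊛ (g ⊛ h)
⊛-assoc f g h = coeffwise coefficient
  where
  coefficient : ∀ N → ((f ⊛ g) ⊛ h) N ≡ (f ⊛ (g ⊛ h)) N
  coefficient N = begin
    sumTo (λ i → sumTo (λ a → f a *ω g (i ∸ a)) (suc i) *ω h (N ∸ i)) (suc N)
      ≡⟨ sumTo-cong (suc N) (λ i i≤N → trans (*ω-distribʳ-sumTo (h (N ∸ i)) (λ a → f a *ω g (i ∸ a)) (suc i))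
           (trans (sym (sumTo-when≤-upTo i (N ∸ i) (λ a → term a i)))
                  (cong (sumTo (λ a → when≤ a i (term a i))) (ℕP.m+[n∸m]≡n i≤N)))) ⟩
    sumTo (λ i → sumTo (λ a → when≤ a i (term a i)) (suc N)) (suc N)
      ≡⟨ sumTo-comm (λ i a → when≤ a i (term a i)) (suc N) (suc N) ⟩
    sumTo (λ a → sumTo (λ i → when≤ a i (term a i)) (suc N)) (suc N)
      ≡⟨ sumTo-cong (suc N) (λ a a≤N → trans (sumTo-when≤-from a N (term a) (ℕP.≤-pred a≤N)) (inner a)) ⟩
    sumTo (λ a → f a *ω sumTo (λ b → g b *ω h (N ∸ a ∸ b)) (suc (N ∸ a))) (suc N) ∎
    where
    open ≡-Reasoning
    term : ℕ → ℕ → ℤω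
    term a i = (f a *ω g (i ∸ a)) *ω h (N ∸ i)
    inner : ∀ a → sumTo (λ b → term a (a + b)) (suc (N ∸ a)) ≡ f a *ω sumTo (λ b → g b *ω h (N ∸ a ∸ b)) (suc (N ∸ a))
    inner a = trans (sumTo-cong (suc (N ∸ a)) (λ b _ → trans (*ω-assoc (f a) _ _)
                      (cong₂ (λ u v → f a *ω (g u *ω h v)) (ℕP.m+n∸m≡n a b) (sym (ℕP.∸-+-assoc N a b)))))
                    (sym (*ω-distribˡ-sumTo (f a) (λ b → g b *ω h (N ∸ a ∸ b)) (suc (N ∸ a))))

-- Opaque copies of _⊕_, _⊛_ and neg: solver goals then compare series
-- expressions syntactically instead of unfolding them into coefficient sums.
opaque
  infixl 6 _⊞_
  infixl 7 _⊠_
  infix  8 ⊟_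

  _⊞_ : PS → PS → PS
  _⊞_ = _⊕_

  _⊠_ : PS → PS → PS
  _⊠_ = _⊛_

  ⊟_ : PS → PS
  ⊟_ = neg

𝟘 : PS
𝟘 = const 0ω

𝟘-coeff : ∀ N → 𝟘 N ≡ 0ω
𝟘-coeff zero    = refl
𝟘-coeff (suc N) = refl

opaque
  unfolding _⊠_

  ⊕≈⊞ : ∀ f g → f ⊕ g ≈ f ⊞ g
  ⊕≈⊞ f g = ≈-refl

  ⊛≈⊠ : ∀ f g → f ⊛ g ≈ f ⊠ g
  ⊛≈⊠ f g = ≈-refl

  neg≈⊟ : ∀ f → neg f ≈ ⊟ f
  neg≈⊟ f = ≈-refl

  ⊞-cong-≈[] : ∀ {f f′ g g′} K → f ≈[ K ] f′ → g ≈[ K ] g′ → f ⊞ g ≈[ K ] f′ ⊞ g′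
  ⊞-cong-≈[] K f≈f′ g≈g′ = coeffwise< λ N N<K → cong₂ _+ω_ (coeff< f≈f′ N N<K) (coeff< g≈g′ N N<K)

  ⊟-cong-≈[] : ∀ {f f′} K → f ≈[ K ] f′ → ⊟ f ≈[ K ] ⊟ f′
  ⊟-cong-≈[] K f≈f′ = coeffwise< λ N N<K → cong -ω_ (coeff< f≈f′ N N<K)

  ⊠-cong-≈[] : ∀ {f f′ g g′} K → f ≈[ K ] f′ → g ≈[ K ] g′ → f ⊠ g ≈[ K ] f′ ⊠ g′
  ⊠-cong-≈[] = ⊛-cong-≈[]

  ⊞-coeff : ∀ f g N → (f ⊞ g) N ≡ f N +ω g N
  ⊞-coeff f g N = refl

  ⊟-coeff : ∀ f N → (⊟ f) N ≡ -ω f N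
  ⊟-coeff f N = refl

  const-⊠-coeff : ∀ c f N → (const c ⊠ f) N ≡ c *ω f N
  const-⊠-coeff = const-⊛

  ⊠-coeff₀ : ∀ f g → (f ⊠ g) 0 ≡ f 0 *ω g 0
  ⊠-coeff₀ f g = +ω-identityˡ (f 0 *ω g 0)

  ⊞-cong : ∀ {f f′ g g′} → f ≈ f′ → g ≈ g′ → f ⊞ g ≈ f′ ⊞ g′
  ⊞-cong f≈f′ g≈g′ = coeffwise λ N → cong₂ _+ω_ (coeff f≈f′ N) (coeff g≈g′ N)

  ⊞-comm : ∀ f g → f ⊞ g ≈ g ⊞ f
  ⊞-comm f g = coeffwise λ N → +ω-comm (f N) (g N)

  ⊞-assoc : ∀ f g h → (f ⊞ g) ⊞ h ≈ f ⊞ (g ⊞ h)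
  ⊞-assoc f g h = coeffwise λ N → +ω-assoc (f N) (g N) (h N)

  ⊞-identityˡ : ∀ f → 𝟘 ⊞ f ≈ f
  ⊞-identityˡ f = coeffwise λ N → trans (cong (_+ω f N) (𝟘-coeff N)) (+ω-identityˡ (f N))

  ⊞-identityʳ : ∀ f → f ⊞ 𝟘 ≈ f
  ⊞-identityʳ f = coeffwise λ N → trans (cong (f N +ω_) (𝟘-coeff N)) (+ω-identityʳ (f N))

  ⊟-cong : ∀ {f f′} → f ≈ f′ → ⊟ f ≈ ⊟ f′
  ⊟-cong f≈f′ = coeffwise λ N → cong -ω_ (coeff f≈f′ N)

  ⊟-inverseʳ : ∀ f → f ⊞ ⊟ f ≈ 𝟘
  ⊟-inverseʳ f = coeffwise λ N → trans (+ω-inverseʳ (f N)) (sym (𝟘-coeff N))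

  ⊟-inverseˡ : ∀ f → ⊟ f ⊞ f ≈ 𝟘
  ⊟-inverseˡ f = coeffwise λ N → trans (+ω-comm (-ω f N) (f N)) (trans (+ω-inverseʳ (f N)) (sym (𝟘-coeff N)))

  ⊠-cong : ∀ {f f′ g g′} → f ≈ f′ → g ≈ g′ → f ⊠ g ≈ f′ ⊠ g′
  ⊠-cong = ⊛-cong

  ⊠-comm : ∀ f g → f ⊠ g ≈ g ⊠ f
  ⊠-comm = ⊛-comm

  ⊠-assoc : ∀ f g h → (f ⊠ g) ⊠ h ≈ f ⊠ (g ⊠ h)
  ⊠-assoc = ⊛-assoc

  ⊠-identityˡ : ∀ f → one ⊠ f ≈ f
  ⊠-identityˡ = ⊛-identityˡ

  ⊠-identityʳ : ∀ f → f ⊠ one ≈ f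
  ⊠-identityʳ f = ≈-trans (⊛-comm f one) (⊛-identityˡ f)

  ⊠-distribˡ-⊞ : ∀ f g h → f ⊠ (g ⊞ h) ≈ f ⊠ g ⊞ f ⊠ h
  ⊠-distribˡ-⊞ = ⊛-distribˡ-⊕

  ⊠-distribʳ-⊞ : ∀ f g h → (g ⊞ h) ⊠ f ≈ g ⊠ f ⊞ h ⊠ f
  ⊠-distribʳ-⊞ f g h = ≈-trans (⊛-comm (g ⊕ h) f) (≈-trans (⊛-distribˡ-⊕ f g h)
                                 (⊞-cong (⊛-comm f g) (⊛-comm f h)))

ps-commutativeRing : CommutativeRing 0ℓ 0ℓ
ps-commutativeRing = record
  { Carrier = PS ; _≈_ = _≈_ ; _+_ = _⊞_ ; _*_ = _⊠_ ; -_ = ⊟_ ; 0# = 𝟘 ; 1# = one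
  ; isCommutativeRing = record
    { isRing = record
      { +-isAbelianGroup = record
        { isGroup = record
          { isMonoid = record
            { isSemigroup = record
              { isMagma = record { isEquivalence = Setoid.isEquivalence ≈-setoid ; ∙-cong = ⊞-cong }
              ; assoc = ⊞-assoc }
            ; identity = ⊞-identityˡ , ⊞-identityʳ }
          ; inverse = ⊟-inverseˡ , ⊟-inverseʳ
          ; ⁻¹-cong = ⊟-cong }
        ; comm = ⊞-comm }
      ; *-cong = ⊠-cong ; *-assoc = ⊠-assoc ; *-identity = ⊠-identityˡ , ⊠-identityʳ
      ; distrib = ⊠-distribˡ-⊞ , ⊠-distribʳ-⊞ }
    ; *-comm = ⊠-comm } }

module ≈-Reasoning = Relation.Binary.Reasoning.Setoid ≈-setoid

ℤ→PS : ℤ → PS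
ℤ→PS a = const (mkω a (+ 0))

opaque
  unfolding _⊠_

  ℤ→PS-+ : ∀ a b → ℤ→PS (a ℤ.+ b) ≈ ℤ→PS a ⊞ ℤ→PS b
  ℤ→PS-+ a b = coeffwise λ { zero → refl ; (suc N) → sym (+ω-identityʳ 0ω) }

  ℤ→PS-* : ∀ a b → ℤ→PS (a ℤ.* b) ≈ ℤ→PS a ⊠ ℤ→PS b
  ℤ→PS-* a b = coeffwise λ N → sym (trans (const-⊛ (mkω a (+ 0)) (ℤ→PS b) N) (lemma N))
    where
    re : ∀ a b → a ℤ.* b ℤ.- + 0 ℤ.* + 0 ≡ a ℤ.* b
    re = ℤ-Solver.solve-∀
    im : ∀ a b → a ℤ.* + 0 ℤ.+ + 0 ℤ.* b ℤ.- + 0 ℤ.* + 0 ≡ + 0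
    im = ℤ-Solver.solve-∀
    lemma : ∀ N → mkω a (+ 0) *ω ℤ→PS b N ≡ ℤ→PS (a ℤ.* b) N
    lemma zero    = cong₂ mkω (re a b) (im a b)
    lemma (suc N) = *ω-zeroʳ (mkω a (+ 0))

  ℤ→PS-neg : ∀ a → ℤ→PS (ℤ.- a) ≈ ⊟ ℤ→PS a
  ℤ→PS-neg a = coeffwise λ { zero → refl ; (suc N) → refl }

module RingSolver where
  import Algebra.Solver.Ring.AlmostCommutativeRing as ACR
  open import Relation.Nullary.Decidable.Core using (dec⇒maybe)
  import Data.Maybe as Maybe

  ℤ→PS-morphism : ℤ.+-*-rawRing ACR.-Raw-AlmostCommutative⟶ ACR.fromCommutativeRing ps-commutativeRing
  ℤ→PS-morphism = record
    { ⟦_⟧ = ℤ→PS ; +-homo = ℤ→PS-+ ; *-homo = ℤ→PS-* ; -‿homo = ℤ→PS-neg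
    ; 0-homo = ≈-refl ; 1-homo = ≈-refl }

  open import Algebra.Solver.Ring ℤ.+-*-rawRing (ACR.fromCommutativeRing ps-commutativeRing) ℤ→PS-morphism
    (λ a b → Maybe.map (λ a≡b → coeffwise λ N → cong (λ t → ℤ→PS t N) a≡b) (dec⇒maybe (a ℤ.≟ b)))
    public

open RingSolver using (_:=_; _:+_; _:*_; :-_; con) renaming (solve to ring-solve)
open import Algebra.Solver.CommutativeMonoid (CommutativeRing.*-commutativeMonoid ps-commutativeRing)
  using (_⊜_; id) renaming (solve to ⊠-solve; _⊕_ to _⊗_)
open import Algebra.Properties.CommutativeSemiring.Exp (CommutativeRing.commutativeSemiring ps-commutativeRing)
  using (_^_; ^-homo-*; ^-assocʳ; ^-distrib-*; ^-congˡ)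
open CommutativeRing ps-commutativeRing using () renaming (zeroˡ to ⊠-zeroˡ; zeroʳ to ⊠-zeroʳ)

Σ< : ℕ → (ℕ → PS) → PS
Σ< L F N = sumTo (λ n → F n N) L

Σ<-cong : ∀ L {F G : ℕ → PS} → (∀ n → n < L → F n ≈ G n) → Σ< L F ≈ Σ< L G
Σ<-cong L F≈G = coeffwise λ N → sumTo-cong L (λ n n<L → coeff (F≈G n n<L) N)

Σ<-cong-≈[] : ∀ L K {F G : ℕ → PS} → (∀ n → n < L → F n ≈[ K ] G n) → Σ< L F ≈[ K ] Σ< L G
Σ<-cong-≈[] L K F≈G = coeffwise< λ N N<K → sumTo-cong L (λ n n<L → coeff< (F≈G n n<L) N N<K)

Σ<-last : ∀ L F → Σ< (suc L) F ≈ Σ< L F ⊞ F L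
Σ<-last L F = ≈-sym (coeffwise (⊞-coeff (Σ< L F) (F L)))

Σ<-head : ∀ L F → Σ< (suc L) F ≈ F 0 ⊞ Σ< L (λ n → F (suc n))
Σ<-head L F = coeffwise λ N → trans (sumTo-head (λ n → F n N) L) (sym (⊞-coeff (F 0) _ N))

Σ<-split : ∀ a k F → Σ< (a + k) F ≈ Σ< a F ⊞ Σ< k (λ b → F (a + b))
Σ<-split a k F = coeffwise λ N → trans (sumTo-split (λ n → F n N) a k) (sym (⊞-coeff (Σ< a F) _ N))

Σ<-reverse : ∀ L F → Σ< L F ≈ Σ< L (λ n → F (L ∸ suc n))
Σ<-reverse L F = coeffwise λ N → sumTo-reverse (λ n → F n N) L

Σ<-⊞ : ∀ L F G → Σ< L (λ n → F n ⊞ G n) ≈ Σ< L F ⊞ Σ< L G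
Σ<-⊞ L F G = coeffwise λ N → begin
  sumTo (λ n → (F n ⊞ G n) N) L        ≡⟨ sumTo-cong L (λ n _ → ⊞-coeff (F n) (G n) N) ⟩
  sumTo (λ n → F n N +ω G n N) L       ≡⟨ sumTo-+ω (λ n → F n N) (λ n → G n N) L ⟩
  Σ< L F N +ω Σ< L G N                 ≡⟨ sym (⊞-coeff (Σ< L F) (Σ< L G) N) ⟩
  (Σ< L F ⊞ Σ< L G) N                  ∎
  where open ≡-Reasoning

Σ<-⊟ : ∀ L F → Σ< L (λ n → ⊟ F n) ≈ ⊟ Σ< L F
Σ<-⊟ L F = coeffwise λ N → begin
  sumTo (λ n → (⊟ F n) N) L            ≡⟨ sumTo-cong L (λ n _ → ⊟-coeff (F n) N) ⟩
  sumTo (λ n → -ω F n N) L             ≡⟨ sym (-ω-sumTo (λ n → F n N) L) ⟩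
  -ω Σ< L F N                          ≡⟨ sym (⊟-coeff (Σ< L F) N) ⟩
  (⊟ Σ< L F) N                         ∎
  where open ≡-Reasoning

opaque
  unfolding _⊠_

  ⊠-distribˡ-Σ< : ∀ L h F → h ⊠ Σ< L F ≈ Σ< L (λ n → h ⊠ F n)
  ⊠-distribˡ-Σ< L h F = coeffwise λ N →
    trans (sumTo-cong (suc N) (λ i _ → *ω-distribˡ-sumTo (h i) (λ n → F n (N ∸ i)) L))
          (sumTo-comm (λ i n → h i *ω F n (N ∸ i)) (suc N) L)

q^_ : ℕ → PS
q^ e = X ^ e

infix 4 q^_∣_
q^_∣_ : ℕ → PS → Set
q^ a ∣ f = ∀ N → N < a → f N ≡ 0ω

-- The families for which sumSeries F, which only adds F n for n ≤ N to the coefficient of q^N,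
-- is the sum of all F n.
Summable : (ℕ → PS) → Set
Summable F = ∀ n → q^ n ∣ F n

q^0∣ : ∀ f → q^ 0 ∣ f
q^0∣ f N ()

q^∣-mono : ∀ {f} {a b} → b ≤ a → q^ a ∣ f → q^ b ∣ f
q^∣-mono b≤a a∣f N N<b = a∣f N (ℕP.<-≤-trans N<b b≤a)

q^∣-resp-≈ : ∀ {f g} {a} → f ≈ g → q^ a ∣ f → q^ a ∣ g
q^∣-resp-≈ f≈g a∣f N N<a = trans (sym (coeff f≈g N)) (a∣f N N<a)

q^∣⇒≈[]𝟘 : ∀ {f} {a} → q^ a ∣ f → f ≈[ a ] 𝟘
q^∣⇒≈[]𝟘 a∣f = coeffwise< λ N N<a → trans (a∣f N N<a) (sym (𝟘-coeff N))

q^∣-⊟ : ∀ {f} {a} → q^ a ∣ f → q^ a ∣ ⊟ f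
q^∣-⊟ {f} a∣f N N<a = trans (⊟-coeff f N) (cong -ω_ (a∣f N N<a))

opaque
  unfolding _⊠_

  q^∣-⊠ : ∀ {f g} a b → q^ a ∣ f → q^ b ∣ g → q^ (a + b) ∣ f ⊠ g
  q^∣-⊠ {f} {g} a b a∣f b∣g N N<a+b = sumTo-zero (suc N) vanishing
    where
    vanishing : ∀ i → i < suc N → f i *ω g (N ∸ i) ≡ 0ω
    vanishing i i≤N with a ℕ.≤? i
    ... | no  a≰i = trans (cong (_*ω g (N ∸ i)) (a∣f i (ℕP.≰⇒> a≰i))) (*ω-zeroˡ (g (N ∸ i)))
    ... | yes a≤i = trans (cong (f i *ω_) (b∣g (N ∸ i) N∸i<b)) (*ω-zeroʳ (f i))
      where
      N∸i<b : N ∸ i < b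
      N∸i<b = ℕP.+-cancelˡ-< i (N ∸ i) b
        (subst (_< i + b) (sym (ℕP.m+[n∸m]≡n (ℕP.≤-pred i≤N))) (ℕP.<-≤-trans N<a+b (ℕP.+-monoˡ-≤ b a≤i)))

  X-⊠-coeff-zero : ∀ f → (X ⊠ f) 0 ≡ 0ω
  X-⊠-coeff-zero f = trans (+ω-identityˡ (0ω *ω f 0)) (*ω-zeroˡ (f 0))

  X-⊠-coeff-suc : ∀ f N → (X ⊠ f) (suc N) ≡ f N
  X-⊠-coeff-suc f N = begin
    sumTo (λ i → X i *ω f (suc N ∸ i)) (suc (suc N))
      ≡⟨ sumTo-head (λ i → X i *ω f (suc N ∸ i)) (suc N) ⟩
    (0ω *ω f (suc N)) +ω sumTo (λ i → X (suc i) *ω f (N ∸ i)) (suc N)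
      ≡⟨ cong₂ _+ω_ (*ω-zeroˡ (f (suc N))) (sumTo-head (λ i → X (suc i) *ω f (N ∸ i)) N) ⟩
    0ω +ω ((1ω *ω f N) +ω sumTo (λ i → 0ω *ω f (N ∸ suc i)) N)
      ≡⟨ +ω-identityˡ _ ⟩
    (1ω *ω f N) +ω sumTo (λ i → 0ω *ω f (N ∸ suc i)) N
      ≡⟨ cong₂ _+ω_ (*ω-identityˡ (f N)) (sumTo-zero N (λ i _ → *ω-zeroˡ (f (N ∸ suc i)))) ⟩
    f N +ω 0ω
      ≡⟨ +ω-identityʳ (f N) ⟩
    f N ∎
    where open ≡-Reasoning

q^-⊠-coeff-+ : ∀ a f N → (q^ a ⊠ f) (a + N) ≡ f N
q^-⊠-coeff-+ zero    f N = coeff (⊠-identityˡ f) N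
q^-⊠-coeff-+ (suc a) f N = begin
  ((X ⊠ q^ a) ⊠ f) (suc a + N)  ≡⟨ coeff (⊠-assoc X (q^ a) f) (suc (a + N)) ⟩
  (X ⊠ (q^ a ⊠ f)) (suc a + N)  ≡⟨ X-⊠-coeff-suc (q^ a ⊠ f) (a + N) ⟩
  (q^ a ⊠ f) (a + N)            ≡⟨ q^-⊠-coeff-+ a f N ⟩
  f N                           ∎
  where open ≡-Reasoning

q^∣q^-⊠ : ∀ a f → q^ a ∣ q^ a ⊠ f
q^∣q^-⊠ (suc a) f zero    _         = trans (coeff (⊠-assoc X (q^ a) f) 0) (X-⊠-coeff-zero (q^ a ⊠ f))
q^∣q^-⊠ (suc a) f (suc N) (s≤s N<a) =
  trans (coeff (⊠-assoc X (q^ a) f) (suc N)) (trans (X-⊠-coeff-suc (q^ a ⊠ f) N) (q^∣q^-⊠ a f N N<a))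

q^∣q^ : ∀ a → q^ a ∣ q^ a
q^∣q^ a = q^∣-resp-≈ (⊠-identityʳ (q^ a)) (q^∣q^-⊠ a one)

q^∣-⊠ˡ : ∀ {f} {a} g → q^ a ∣ f → q^ a ∣ f ⊠ g
q^∣-⊠ˡ {a = a} g a∣f = q^∣-mono (ℕP.m≤m+n a 0) (q^∣-⊠ a 0 a∣f (q^0∣ g))

q^∣-⊠ʳ : ∀ f {g} {a} → q^ a ∣ g → q^ a ∣ f ⊠ g
q^∣-⊠ʳ f a∣g = q^∣-⊠ 0 _ (q^0∣ f) a∣g

q^-⊠-cancel : ∀ a {f g} → q^ a ⊠ f ≈ q^ a ⊠ g → f ≈ g
q^-⊠-cancel a {f} {g} eq = coeffwise λ N →
  trans (sym (q^-⊠-coeff-+ a f N)) (trans (coeff eq (a + N)) (q^-⊠-coeff-+ a g N))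

q^∣-Σ< : ∀ {a} L F → (∀ n → n < L → q^ a ∣ F n) → q^ a ∣ Σ< L F
q^∣-Σ< L F a∣F N N<a = sumTo-zero L (λ n n<L → a∣F n n<L N N<a)

sumSeries-≈[]-Σ< : ∀ K F → Summable F → sumSeries F ≈[ K ] Σ< K F
sumSeries-≈[]-Σ< K F summable = coeffwise< λ N N<K → begin
  sumTo (λ n → F n N) (suc N)
    ≡⟨ sym (+ω-identityʳ _) ⟩
  sumTo (λ n → F n N) (suc N) +ω 0ω
    ≡⟨ cong (sumTo (λ n → F n N) (suc N) +ω_) (sym (sumTo-zero (K ∸ suc N) (λ b _ → summable (suc N + b) N (s≤s (ℕP.m≤m+n N b))))) ⟩
  sumTo (λ n → F n N) (suc N) +ω sumTo (λ b → F (suc N + b) N) (K ∸ suc N)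
    ≡⟨ sym (sumTo-split (λ n → F n N) (suc N) (K ∸ suc N)) ⟩
  sumTo (λ n → F n N) (suc N + (K ∸ suc N))
    ≡⟨ cong (sumTo (λ n → F n N)) (ℕP.m+[n∸m]≡n N<K) ⟩
  Σ< K F N ∎
  where open ≡-Reasoning

sumTo-when≤-reindex : ∀ a K (g : ℕ → ℤω) → (∀ r → K ≤ a + r → g r ≡ 0ω) →
                      sumTo g K ≡ sumTo (λ t → when≤ a t (g (t ∸ a))) K
sumTo-when≤-reindex a K g g≡0 with a ℕ.≤? K
... | no a≰K = trans (sumTo-zero K (λ r _ → g≡0 r (ℕP.≤-trans (ℕP.<⇒≤ (ℕP.≰⇒> a≰K)) (ℕP.m≤m+n a r))))
                     (sym (sumTo-zero K (λ t t<K → when≤-no _ (ℕP.<-trans t<K (ℕP.≰⇒> a≰K)))))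
... | yes a≤K = begin
  sumTo g K
    ≡⟨ cong (sumTo g) (sym (ℕP.m∸n+n≡m a≤K)) ⟩
  sumTo g (d + a)
    ≡⟨ sumTo-split g d a ⟩
  sumTo g d +ω sumTo (λ b → g (d + b)) a
    ≡⟨ cong (sumTo g d +ω_) (sumTo-zero a (λ b _ → g≡0 (d + b) (K≤a+[d+b] b))) ⟩
  sumTo g d +ω 0ω
    ≡⟨ +ω-identityʳ (sumTo g d) ⟩
  sumTo g d
    ≡⟨ sumTo-cong d (λ r _ → cong g (sym (ℕP.m+n∸m≡n a r))) ⟩
  sumTo (λ r → g (a + r ∸ a)) d
    ≡⟨ sym (sumTo-when≤-shift a d (λ t → g (t ∸ a))) ⟩
  sumTo (λ t → when≤ a t (g (t ∸ a))) (a + d)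
    ≡⟨ cong (sumTo (λ t → when≤ a t (g (t ∸ a)))) (ℕP.m+[n∸m]≡n a≤K) ⟩
  sumTo (λ t → when≤ a t (g (t ∸ a))) K ∎
  where
  open ≡-Reasoning
  d = K ∸ a
  K≤a+[d+b] : ∀ b → K ≤ a + (d + b)
  K≤a+[d+b] b = ℕP.≤-trans (ℕP.≤-reflexive (sym (ℕP.m+[n∸m]≡n a≤K))) (ℕP.+-monoʳ-≤ a (ℕP.m≤m+n d b))

module _ (c : ℕ) .{{_ : ℕ.NonZero c}} where

  ≤/⇒*≤ : ∀ {j t} → j ≤ t / c → c * j ≤ t
  ≤/⇒*≤ {j} {t} j≤t/c = ℕP.≤-trans (ℕP.≤-reflexive (ℕP.*-comm c j))
                          (ℕP.≤-trans (ℕP.*-monoˡ-≤ c j≤t/c) (m/n*n≤m t c))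

  />⇒*> : ∀ {j t} → t / c < j → t < c * j
  />⇒*> {j} {t} t/c<j = ℕP.≰⇒> λ cj≤t → ℕP.<⇒≱ t/c<j
    (subst (_≤ t / c) (trans (cong (_/ c) (ℕP.*-comm c j)) (m*n/n≡m j c)) (/-monoˡ-≤ c cj≤t))

  sumTo-when≤-* : ∀ K t (g : ℕ → ℤω) → t < K → sumTo (λ j → when≤ (c * j) t (g j)) K ≡ sumTo g (suc (t / c))
  sumTo-when≤-* K t g t<K = begin
    sumTo (λ j → when≤ (c * j) t (g j)) K
      ≡⟨ cong (sumTo (λ j → when≤ (c * j) t (g j))) (sym (ℕP.m+[n∸m]≡n 1+t/c≤K)) ⟩
    sumTo (λ j → when≤ (c * j) t (g j)) (suc (t / c) + (K ∸ suc (t / c)))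
      ≡⟨ sumTo-split (λ j → when≤ (c * j) t (g j)) (suc (t / c)) (K ∸ suc (t / c)) ⟩
    sumTo (λ j → when≤ (c * j) t (g j)) (suc (t / c)) +ω sumTo (λ b → when≤ (c * (suc (t / c) + b)) t _) (K ∸ suc (t / c))
      ≡⟨ cong₂ _+ω_ (sumTo-cong (suc (t / c)) (λ j j≤t/c → when≤-yes (g j) (≤/⇒*≤ (ℕP.≤-pred j≤t/c))))
                    (sumTo-zero (K ∸ suc (t / c)) (λ b _ → when≤-no _ (/>⇒*> (s≤s (ℕP.m≤m+n (t / c) b))))) ⟩
    sumTo g (suc (t / c)) +ω 0ω
      ≡⟨ +ω-identityʳ (sumTo g (suc (t / c))) ⟩
    sumTo g (suc (t / c)) ∎
    where
    open ≡-Reasoning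
    1+t/c≤K : suc (t / c) ≤ K
    1+t/c≤K = ℕP.≤-trans (s≤s (m/n≤m t c)) t<K

  Σ<-Σ<-diagonal : ∀ K (G : ℕ → ℕ → PS) → (∀ j r → q^ (c * j + r) ∣ G j r) →
                   Σ< K (λ j → Σ< K (G j)) ≈[ K ] Σ< K (λ t → Σ< (suc (t / c)) (λ j → G j (t ∸ c * j)))
  Σ<-Σ<-diagonal K G G-ord = coeffwise< λ N N<K → begin
    sumTo (λ j → sumTo (λ r → G j r N) K) K
      ≡⟨ sumTo-cong K (λ j _ → sumTo-when≤-reindex (c * j) K (λ r → G j r N)
                                 (λ r K≤cj+r → G-ord j r N (ℕP.<-≤-trans N<K K≤cj+r))) ⟩
    sumTo (λ j → sumTo (λ t → when≤ (c * j) t (G j (t ∸ c * j) N)) K) K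
      ≡⟨ sumTo-comm (λ j t → when≤ (c * j) t (G j (t ∸ c * j) N)) K K ⟩
    sumTo (λ t → sumTo (λ j → when≤ (c * j) t (G j (t ∸ c * j) N)) K) K
      ≡⟨ sumTo-cong K (λ t t<K → sumTo-when≤-* K t (λ j → G j (t ∸ c * j) N) t<K) ⟩
    sumTo (λ t → sumTo (λ j → G j (t ∸ c * j) N) (suc (t / c))) K ∎
    where open ≡-Reasoning

Σ<-Σ<-antidiagonal : ∀ K (G : ℕ → ℕ → PS) → (∀ j r → q^ (j + r) ∣ G j r) →
                     Σ< K (λ j → Σ< K (G j)) ≈[ K ] Σ< K (λ t → Σ< (suc t) (λ j → G j (t ∸ j)))
Σ<-Σ<-antidiagonal K G G-ord = begin
  Σ< K (λ j → Σ< K (G j))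
    ≈⟨ Σ<-Σ<-diagonal 1 K G (λ j r → subst (λ a → q^ a + r ∣ G j r) (sym (ℕP.*-identityˡ j)) (G-ord j r)) ⟩
  Σ< K (λ t → Σ< (suc (t / 1)) (λ j → G j (t ∸ 1 * j)))
    ≈⟨ ≈⇒≈[] K (Σ<-cong K (λ t _ → ≈-trans (coeffwise λ N → cong (λ u → Σ< (suc u) (λ j → G j (t ∸ 1 * j)) N) (n/1≡n t))
         (Σ<-cong (suc t) (λ j _ → coeffwise λ N → cong (λ u → G j (t ∸ u) N) (ℕP.*-identityˡ j))))) ⟩
  Σ< K (λ t → Σ< (suc t) (λ j → G j (t ∸ j))) ∎
  where
  open ≈[]-Reasoning K

ConstTerm1 : PS → Set
ConstTerm1 f = f 0 ≡ 1ω

module _ where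
  open import Data.Fin as Fin using (Fin; toℕ)
  import Data.Vec as Vec

  private
    invVec-lookup : ∀ f N (i : Fin (suc N)) → Vec.lookup (invVec f N) i ≡ inv f (N ∸ toℕ i)
    invVec-lookup f zero    Fin.zero    = refl
    invVec-lookup f (suc N) Fin.zero    = refl
    invVec-lookup f (suc N) (Fin.suc i) = invVec-lookup f N i

    sumFin-cong : ∀ n {h h′ : Fin n → ℤω} → (∀ i → h i ≡ h′ i) → sumFin n h ≡ sumFin n h′
    sumFin-cong zero    h≡h′ = refl
    sumFin-cong (suc n) h≡h′ = cong₂ _+ω_ (h≡h′ Fin.zero) (sumFin-cong n (λ i → h≡h′ (Fin.suc i)))

    sumFin-sumTo : ∀ n (F : ℕ → ℤω) → sumFin n (λ i → F (toℕ i)) ≡ sumTo F n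
    sumFin-sumTo zero    F = refl
    sumFin-sumTo (suc n) F = trans (cong (F 0 +ω_) (sumFin-sumTo n (λ i → F (suc i)))) (sym (sumTo-head F n))

  opaque
    unfolding _⊠_

    ⊠-inverseʳ : ∀ {f} → ConstTerm1 f → f ⊠ inv f ≈ one
    ⊠-inverseʳ {f} f₀≡1 = coeffwise coefficient
      where
      coefficient : ∀ N → (f ⊛ inv f) N ≡ one N
      coefficient zero    = trans (+ω-identityˡ (f 0 *ω 1ω)) (trans (*ω-identityʳ (f 0)) f₀≡1)
      coefficient (suc N) = begin
        sumTo (λ i → f i *ω inv f (suc N ∸ i)) (suc (suc N))
          ≡⟨ sumTo-head (λ i → f i *ω inv f (suc N ∸ i)) (suc N) ⟩
        (f 0 *ω inv f (suc N)) +ω S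
          ≡⟨ cong (λ t → (t *ω inv f (suc N)) +ω S) f₀≡1 ⟩
        (1ω *ω inv f (suc N)) +ω S
          ≡⟨ cong (_+ω S) (*ω-identityˡ (inv f (suc N))) ⟩
        (-ω sumFin (suc N) (λ i → f (suc (toℕ i)) *ω Vec.lookup (invVec f N) i)) +ω S
          ≡⟨ cong (λ t → (-ω t) +ω S)
               (trans (sumFin-cong (suc N) (λ i → cong (f (suc (toℕ i)) *ω_) (invVec-lookup f N i)))
                      (sumFin-sumTo (suc N) (λ i → f (suc i) *ω inv f (N ∸ i)))) ⟩
        (-ω S) +ω S
          ≡⟨ trans (+ω-comm (-ω S) S) (+ω-inverseʳ S) ⟩
        0ω ∎
        where
        open ≡-Reasoning
        S : ℤω
        S = sumTo (λ i → f (suc i) *ω inv f (N ∸ i)) (suc N)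

⊠-inverseˡ : ∀ {f} → ConstTerm1 f → inv f ⊠ f ≈ one
⊠-inverseˡ {f} f₀≡1 = ≈-trans (⊠-comm (inv f) f) (⊠-inverseʳ f₀≡1)

ConstTerm1-resp-≈ : ∀ {f g} → f ≈ g → ConstTerm1 f → ConstTerm1 g
ConstTerm1-resp-≈ f≈g f₀≡1 = trans (sym (coeff f≈g 0)) f₀≡1

ConstTerm1-⊠ : ∀ {f g} → ConstTerm1 f → ConstTerm1 g → ConstTerm1 (f ⊠ g)
ConstTerm1-⊠ {f} {g} f₀≡1 g₀≡1 = trans (⊠-coeff₀ f g) (trans (cong₂ _*ω_ f₀≡1 g₀≡1) (*ω-identityʳ 1ω))

ConstTerm1-one⊞ : ∀ {f} → q^ 1 ∣ f → ConstTerm1 (one ⊞ f)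
ConstTerm1-one⊞ {f} q∣f = trans (⊞-coeff one f 0) (trans (cong (1ω +ω_) (q∣f 0 (s≤s z≤n))) (+ω-identityʳ 1ω))

ConstTerm1-one⊞q^ : ∀ c e → ConstTerm1 (one ⊞ c ⊠ q^ (suc e))
ConstTerm1-one⊞q^ c e = ConstTerm1-one⊞ (q^∣-resp-≈ (⊠-comm (q^ (suc e)) c)
                          (q^∣-mono (s≤s z≤n) (q^∣q^-⊠ (suc e) c)))

inv-unique : ∀ {f g} → ConstTerm1 f → f ⊠ g ≈ one → g ≈ inv f
inv-unique {f} {g} f₀≡1 fg≈1 = begin
  g                   ≈⟨ ⊠-identityʳ g ⟨
  g ⊠ one             ≈⟨ ⊠-cong ≈-refl (⊠-inverseʳ f₀≡1) ⟨
  g ⊠ (f ⊠ inv f)     ≈⟨ ⊠-assoc g f (inv f) ⟨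
  (g ⊠ f) ⊠ inv f     ≈⟨ ⊠-cong (≈-trans (⊠-comm g f) fg≈1) ≈-refl ⟩
  one ⊠ inv f         ≈⟨ ⊠-identityˡ (inv f) ⟩
  inv f               ∎
  where open ≈-Reasoning

inv-cong : ∀ {f g} → ConstTerm1 f → f ≈ g → inv f ≈ inv g
inv-cong f₀≡1 f≈g = inv-unique (ConstTerm1-resp-≈ f≈g f₀≡1) (≈-trans (⊠-cong (≈-sym f≈g) ≈-refl) (⊠-inverseʳ f₀≡1))

inv-⊠ : ∀ {f g} → ConstTerm1 f → ConstTerm1 g → inv (f ⊠ g) ≈ inv f ⊠ inv g
inv-⊠ {f} {g} f₀≡1 g₀≡1 = ≈-sym (inv-unique (ConstTerm1-⊠ f₀≡1 g₀≡1) (begin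
  (f ⊠ g) ⊠ (inv f ⊠ inv g)  ≈⟨ ⊠-solve 4 (λ a b c d → (a ⊗ b) ⊗ (c ⊗ d) ⊜ (a ⊗ c) ⊗ (b ⊗ d)) ≈-refl f g (inv f) (inv g) ⟩
  (f ⊠ inv f) ⊠ (g ⊠ inv g)  ≈⟨ ⊠-cong (⊠-inverseʳ f₀≡1) (⊠-inverseʳ g₀≡1) ⟩
  one ⊠ one                  ≈⟨ ⊠-identityˡ one ⟩
  one                        ∎))
  where open ≈-Reasoning

q^-≡ : ∀ {a b} → a ≡ b → q^ a ≈ q^ b
q^-≡ refl = ≈-refl

q^-+ : ∀ a b → q^ (a + b) ≈ q^ a ⊠ q^ b
q^-+ = ^-homo-* X

q^-* : ∀ a b → q^ a ^ b ≈ q^ (a * b)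
q^-* = ^-assocʳ X

pow≈^ : ∀ f n → pow f n ≈ f ^ n
pow≈^ f zero    = ≈-refl
pow≈^ f (suc n) = ≈-trans (⊛-cong (pow≈^ f n) (≈-refl {f})) (≈-trans (⊛≈⊠ (f ^ n) f) (⊠-comm (f ^ n) f))

const-⊞ : ∀ a b → const a ⊞ const b ≈ const (a +ω b)
const-⊞ a b = coeffwise λ { zero → ⊞-coeff (const a) (const b) 0
                          ; (suc N) → trans (⊞-coeff (const a) (const b) (suc N)) (+ω-identityʳ 0ω) }

const-⊠ : ∀ a b → const a ⊠ const b ≈ const (a *ω b)
const-⊠ a b = coeffwise λ { zero → const-⊠-coeff a (const b) 0
                          ; (suc N) → trans (const-⊠-coeff a (const b) (suc N)) (*ω-zeroʳ a) }

const-≡ : ∀ {a b} → a ≡ b → const a ≈ const b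
const-≡ refl = ≈-refl

∏< : ℕ → (ℕ → PS) → PS
∏< zero    f = one
∏< (suc n) f = ∏< n f ⊠ f n

∏<-cong : ∀ n {f g} → (∀ k → k < n → f k ≈ g k) → ∏< n f ≈ ∏< n g
∏<-cong zero    f≈g = ≈-refl
∏<-cong (suc n) f≈g = ⊠-cong (∏<-cong n (λ k k<n → f≈g k (ℕP.m≤n⇒m≤1+n k<n))) (f≈g n ℕP.≤-refl)

∏<-⊠ : ∀ n f g → ∏< n (λ k → f k ⊠ g k) ≈ ∏< n f ⊠ ∏< n g
∏<-⊠ zero    f g = ≈-sym (⊠-identityˡ one)
∏<-⊠ (suc n) f g = ≈-trans (⊠-cong (∏<-⊠ n f g) ≈-refl)
  (⊠-solve 4 (λ a b c d → (a ⊗ b) ⊗ (c ⊗ d) ⊜ (a ⊗ c) ⊗ (b ⊗ d)) ≈-refl (∏< n f) (∏< n g) (f n) (g n))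

∏<-split : ∀ a b f → ∏< (a + b) f ≈ ∏< a f ⊠ ∏< b (λ k → f (a + k))
∏<-split a zero    f = ≈-trans (coeffwise λ N → cong (λ t → ∏< t f N) (ℕP.+-identityʳ a)) (≈-sym (⊠-identityʳ (∏< a f)))
∏<-split a (suc b) f = ≈-trans (coeffwise λ N → cong (λ t → ∏< t f N) (ℕP.+-suc a b))
  (≈-trans (⊠-cong (∏<-split a b f) ≈-refl) (⊠-assoc (∏< a f) (∏< b (λ k → f (a + k))) (f (a + b))))

∏<-reverse : ∀ n f → ∏< n f ≈ ∏< n (λ k → f (n ∸ suc k))
∏<-reverse zero    f = ≈-refl
∏<-reverse (suc n) f = begin
  ∏< n f ⊠ f n                                     ≈⟨ ⊠-comm (∏< n f) (f n) ⟩
  f n ⊠ ∏< n f                                     ≈⟨ ⊠-cong ≈-refl (∏<-reverse n f) ⟩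
  f n ⊠ ∏< n (λ k → f (n ∸ suc k))                 ≈⟨ ⊠-cong (⊠-identityˡ (f n)) ≈-refl ⟨
  (one ⊠ f n) ⊠ ∏< n (λ k → f (n ∸ suc k))         ≈⟨ ∏<-split 1 n (λ k → f (suc n ∸ suc k)) ⟨
  ∏< (suc n) (λ k → f (suc n ∸ suc k))             ∎
  where open ≈-Reasoning

∏<-const : ∀ n c → ∏< n (λ _ → c) ≈ c ^ n
∏<-const zero    c = ≈-refl
∏<-const (suc n) c = ≈-trans (⊠-cong (∏<-const n c) ≈-refl) (⊠-comm (c ^ n) c)

∏<-odd-powers : ∀ n → ∏< n (λ k → q^ (suc (2 * k))) ≈ q^ (n * n)
∏<-odd-powers zero    = ≈-refl
∏<-odd-powers (suc n) = begin
  ∏< n (λ k → q^ (suc (2 * k))) ⊠ q^ (suc (2 * n))  ≈⟨ ⊠-cong (∏<-odd-powers n) ≈-refl ⟩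
  q^ (n * n) ⊠ q^ (suc (2 * n))                     ≈⟨ q^-+ (n * n) (suc (2 * n)) ⟨
  q^ (n * n + suc (2 * n))                          ≈⟨ q^-≡ (square-suc n) ⟩
  q^ (suc n * suc n)                                ∎
  where
  open ≈-Reasoning
  square-suc : ∀ n → n * n + suc (2 * n) ≡ suc n * suc n
  square-suc = solve-∀

ConstTerm1-∏< : ∀ n f → (∀ k → ConstTerm1 (f k)) → ConstTerm1 (∏< n f)
ConstTerm1-∏< zero    f f₀≡1 = refl
ConstTerm1-∏< (suc n) f f₀≡1 = ConstTerm1-⊠ (ConstTerm1-∏< n f f₀≡1) (f₀≡1 n)

qPoch≈∏< : ∀ a b n → qPoch a b n ≈ ∏< n (λ k → one ⊞ ⊟ (a ⊠ b ^ k))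
qPoch≈∏< a b zero    = ≈-refl
qPoch≈∏< a b (suc n) = ≈-trans (⊛-cong (qPoch≈∏< a b n) factor) (⊛≈⊠ _ _)
  where
  factor : one ⊖ (a ⊛ pow b n) ≈ one ⊞ ⊟ (a ⊠ b ^ n)
  factor = ≈-trans (⊕≈⊞ one _) (⊞-cong ≈-refl (≈-trans (neg≈⊟ _)
             (⊟-cong (≈-trans (⊛≈⊠ a _) (⊠-cong ≈-refl (pow≈^ b n))))))

≤-+-elim : ∀ {i M} (P : ℕ → Set) → i ≤ M → (∀ d → P (i + d)) → P M
≤-+-elim P i≤M P[i+_] = subst P (ℕP.m+[n∸m]≡n i≤M) P[i+ _ ]

poch : ℕ → PS
poch n = ∏< n (λ k → one ⊞ ⊟ q^ (2 * suc k))

ConstTerm1-poch : ∀ n → ConstTerm1 (poch n)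
ConstTerm1-poch n = ConstTerm1-∏< n _ λ k →
  ConstTerm1-one⊞ (q^∣-⊟ (q^∣-mono (s≤s z≤n) (q^∣q^ (2 * suc k))))

qbinom : ℕ → ℕ → PS
qbinom M       zero    = one
qbinom zero    (suc i) = 𝟘
qbinom (suc M) (suc i) = qbinom M (suc i) ⊞ q^ (2 * (M ∸ i)) ⊠ qbinom M i

qbinom-vanish : ∀ M i → M < i → qbinom M i ≈ 𝟘
qbinom-vanish zero    (suc i) _         = ≈-refl
qbinom-vanish (suc M) (suc i) (s≤s M<i) = begin
  qbinom M (suc i) ⊞ q^ (2 * (M ∸ i)) ⊠ qbinom M i
    ≈⟨ ⊞-cong (qbinom-vanish M (suc i) (ℕP.m≤n⇒m≤1+n M<i)) (⊠-cong ≈-refl (qbinom-vanish M i M<i)) ⟩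
  𝟘 ⊞ q^ (2 * (M ∸ i)) ⊠ 𝟘
    ≈⟨ ring-solve 1 (λ D → con (+ 0) :+ D :* con (+ 0) := con (+ 0)) ≈-refl (q^ (2 * (M ∸ i))) ⟩
  𝟘 ∎
  where open ≈-Reasoning

qbinom-poch : ∀ M i → i ≤ M → qbinom M i ⊠ poch i ⊠ poch (M ∸ i) ≈ poch M
qbinom-suc-poch : ∀ M i → i ≤ M → qbinom M (suc i) ⊠ poch (suc i) ⊠ poch (M ∸ i) ≈ poch M ⊠ (one ⊞ ⊟ q^ (2 * (M ∸ i)))

qbinom-poch zero    zero    _ = ⊠-solve 0 ((id ⊗ id) ⊗ id ⊜ id) ≈-refl
qbinom-poch (suc M) zero    _ = ⊠-solve 1 (λ P → (id ⊗ id) ⊗ P ⊜ P) ≈-refl (poch (suc M))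
qbinom-poch (suc M) (suc i) (s≤s i≤M) = begin
  (A ⊞ D ⊠ B) ⊠ (Pi ⊠ (one ⊞ ⊟ Q)) ⊠ PMi
    ≈⟨ ring-solve 7 (λ A B D Pi PMi Q P → (A :+ D :* B) :* (Pi :* (con (+ 1) :+ :- Q)) :* PMi
                    := A :* (Pi :* (con (+ 1) :+ :- Q)) :* PMi :+ D :* (B :* Pi :* PMi :* (con (+ 1) :+ :- Q)))
                    ≈-refl A B D Pi PMi Q (poch M) ⟩
  A ⊠ (Pi ⊠ (one ⊞ ⊟ Q)) ⊠ PMi ⊞ D ⊠ (B ⊠ Pi ⊠ PMi ⊠ (one ⊞ ⊟ Q))
    ≈⟨ ⊞-cong (qbinom-suc-poch M i i≤M) (⊠-cong ≈-refl (⊠-cong (qbinom-poch M i i≤M) ≈-refl)) ⟩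
  poch M ⊠ (one ⊞ ⊟ D) ⊞ D ⊠ (poch M ⊠ (one ⊞ ⊟ Q))
    ≈⟨ ring-solve 3 (λ P D Q → P :* (con (+ 1) :+ :- D) :+ D :* (P :* (con (+ 1) :+ :- Q))
                             := P :* (con (+ 1) :+ :- (D :* Q))) ≈-refl (poch M) D Q ⟩
  poch M ⊠ (one ⊞ ⊟ (D ⊠ Q))
    ≈⟨ ⊠-cong ≈-refl (⊞-cong ≈-refl (⊟-cong (≈-trans (≈-sym (q^-+ (2 * (M ∸ i)) (2 * suc i)))
                                                      (q^-≡ (≤-+-elim (λ M → 2 * (M ∸ i) + 2 * suc i ≡ 2 * suc M) i≤M exponent))))) ⟩
  poch (suc M) ∎
  where
  open ≈-Reasoning
  A = qbinom M (suc i)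
  B = qbinom M i
  D = q^ (2 * (M ∸ i))
  Q = q^ (2 * suc i)
  Pi = poch i
  PMi = poch (M ∸ i)
  exponent : ∀ d → 2 * (i + d ∸ i) + 2 * suc i ≡ 2 * suc (i + d)
  exponent d = trans (cong (λ t → 2 * t + 2 * suc i) (ℕP.m+n∸m≡n i d)) (lemma i d)
    where
    lemma : ∀ i d → 2 * d + 2 * suc i ≡ 2 * suc (i + d)
    lemma = solve-∀

qbinom-suc-poch M i i≤M with i ℕ.<? M
... | yes i<M = begin
  qbinom M (suc i) ⊠ poch (suc i) ⊠ poch (M ∸ i)
    ≈⟨ ⊠-cong ≈-refl (coeffwise λ N → cong (λ t → poch t N) (sym M∸i≡1+M∸1+i)) ⟩
  qbinom M (suc i) ⊠ poch (suc i) ⊠ (poch (M ∸ suc i) ⊠ (one ⊞ ⊟ q^ (2 * suc (M ∸ suc i))))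
    ≈⟨ ⊠-assoc _ _ _ ⟨
  qbinom M (suc i) ⊠ poch (suc i) ⊠ poch (M ∸ suc i) ⊠ (one ⊞ ⊟ q^ (2 * suc (M ∸ suc i)))
    ≈⟨ ⊠-cong (qbinom-poch M (suc i) i<M) (⊞-cong ≈-refl (⊟-cong (q^-≡ (cong (2 *_) M∸i≡1+M∸1+i)))) ⟩
  poch M ⊠ (one ⊞ ⊟ q^ (2 * (M ∸ i))) ∎
  where
  open ≈-Reasoning
  M∸i≡1+M∸1+i : suc (M ∸ suc i) ≡ M ∸ i
  M∸i≡1+M∸1+i = sym (ℕP.+-∸-assoc 1 i<M)
... | no i≮M = begin
  qbinom M (suc i) ⊠ poch (suc i) ⊠ poch (M ∸ i)
    ≈⟨ ⊠-cong (⊠-cong (qbinom-vanish M (suc i) (s≤s i≥M)) ≈-refl) ≈-refl ⟩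
  𝟘 ⊠ poch (suc i) ⊠ poch (M ∸ i)
    ≈⟨ ring-solve 3 (λ A B C → con (+ 0) :* A :* B := C :* (con (+ 1) :+ :- con (+ 1))) ≈-refl
                    (poch (suc i)) (poch (M ∸ i)) (poch M) ⟩
  poch M ⊠ (one ⊞ ⊟ one)
    ≈⟨ ⊠-cong ≈-refl (⊞-cong ≈-refl (⊟-cong (q^-≡ (cong (2 *_) (sym (ℕP.m≤n⇒m∸n≡0 i≥M)))))) ⟩
  poch M ⊠ (one ⊞ ⊟ q^ (2 * (M ∸ i))) ∎
  where
  open ≈-Reasoning
  i≥M : M ≤ i
  i≥M = ℕP.≮⇒≥ i≮M

binomialTerm : ℕ → PS → PS → ℕ → PS
binomialTerm M x y i = q^ (i * i) ⊠ y ^ i ⊠ x ^ (M ∸ i) ⊠ qbinom M i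

binomialTerm-suc : ∀ M x y i → i ≤ M →
  binomialTerm (suc M) x y (suc i) ≈ binomialTerm M x y (suc i) ⊠ x ⊞ binomialTerm M x y i ⊠ (y ⊠ q^ (suc (2 * M)))
binomialTerm-suc M x y i i≤M = begin
  E ⊠ (y ⊠ Y) ⊠ x ^ (M ∸ i) ⊠ (G₁ ⊞ D ⊠ G₀)
    ≈⟨ ⊠-distribˡ-⊞ _ G₁ (D ⊠ G₀) ⟩
  E ⊠ (y ⊠ Y) ⊠ x ^ (M ∸ i) ⊠ G₁ ⊞ E ⊠ (y ⊠ Y) ⊠ x ^ (M ∸ i) ⊠ (D ⊠ G₀)
    ≈⟨ ⊞-cong (⊠-assoc _ (x ^ (M ∸ i)) G₁) ≈-refl ⟩
  E ⊠ (y ⊠ Y) ⊠ (x ^ (M ∸ i) ⊠ G₁) ⊞ E ⊠ (y ⊠ Y) ⊠ x ^ (M ∸ i) ⊠ (D ⊠ G₀)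
    ≈⟨ ⊞-cong (⊠-cong ≈-refl x^[M∸i]⊠G₁) ≈-refl ⟩
  E ⊠ (y ⊠ Y) ⊠ (x ⊠ x ^ (M ∸ suc i) ⊠ G₁) ⊞ E ⊠ (y ⊠ Y) ⊠ x ^ (M ∸ i) ⊠ (D ⊠ G₀)
    ≈⟨ ⊞-cong (⊠-solve 5 (λ E W x Z G → (E ⊗ W) ⊗ ((x ⊗ Z) ⊗ G) ⊜ (((E ⊗ W) ⊗ Z) ⊗ G) ⊗ x) ≈-refl E (y ⊠ Y) x (x ^ (M ∸ suc i)) G₁)
              (⊠-solve 6 (λ E y Y Z D G → ((E ⊗ (y ⊗ Y)) ⊗ Z) ⊗ (D ⊗ G) ⊜ ((((E ⊗ D) ⊗ Y) ⊗ Z) ⊗ G) ⊗ y) ≈-refl E y Y (x ^ (M ∸ i)) D G₀) ⟩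
  binomialTerm M x y (suc i) ⊠ x ⊞ (E ⊠ D) ⊠ Y ⊠ x ^ (M ∸ i) ⊠ G₀ ⊠ y
    ≈⟨ ⊞-cong ≈-refl (⊠-cong (⊠-cong (⊠-cong (⊠-cong E⊠D ≈-refl) ≈-refl) ≈-refl) ≈-refl) ⟩
  binomialTerm M x y (suc i) ⊠ x ⊞ (q^ (i * i) ⊠ q^ (suc (2 * M))) ⊠ Y ⊠ x ^ (M ∸ i) ⊠ G₀ ⊠ y
    ≈⟨ ⊞-cong ≈-refl (⊠-solve 6 (λ E Q Y Z G y → ((((E ⊗ Q) ⊗ Y) ⊗ Z) ⊗ G) ⊗ y ⊜ (((E ⊗ Y) ⊗ Z) ⊗ G) ⊗ (y ⊗ Q)) ≈-refl
                                 (q^ (i * i)) (q^ (suc (2 * M))) Y (x ^ (M ∸ i)) G₀ y) ⟩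
  binomialTerm M x y (suc i) ⊠ x ⊞ binomialTerm M x y i ⊠ (y ⊠ q^ (suc (2 * M))) ∎
  where
  open ≈-Reasoning
  E = q^ (suc i * suc i)
  Y = y ^ i
  D = q^ (2 * (M ∸ i))
  G₀ = qbinom M i
  G₁ = qbinom M (suc i)
  x^[M∸i]⊠G₁ : x ^ (M ∸ i) ⊠ G₁ ≈ x ⊠ x ^ (M ∸ suc i) ⊠ G₁
  x^[M∸i]⊠G₁ with i ℕ.<? M
  ... | yes i<M = ⊠-cong (coeffwise λ N → cong (λ t → (x ^ t) N) (ℕP.+-∸-assoc 1 i<M)) ≈-refl
  ... | no  i≮M = ≈-trans (⊠-cong ≈-refl G₁≈𝟘) (≈-trans (⊠-zeroʳ _) (≈-sym (≈-trans (⊠-cong ≈-refl G₁≈𝟘) (⊠-zeroʳ _))))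
    where
    G₁≈𝟘 : G₁ ≈ 𝟘
    G₁≈𝟘 = qbinom-vanish M (suc i) (s≤s (ℕP.≮⇒≥ i≮M))
  E⊠D : E ⊠ D ≈ q^ (i * i) ⊠ q^ (suc (2 * M))
  E⊠D = ≈-trans (≈-sym (q^-+ (suc i * suc i) (2 * (M ∸ i))))
       (≈-trans (q^-≡ (≤-+-elim (λ M → suc i * suc i + 2 * (M ∸ i) ≡ i * i + suc (2 * M)) i≤M exponent))
                (q^-+ (i * i) (suc (2 * M))))
    where
    lemma : ∀ i d → suc i * suc i + 2 * d ≡ i * i + suc (2 * (i + d))
    lemma = solve-∀
    exponent : ∀ d → suc i * suc i + 2 * (i + d ∸ i) ≡ i * i + suc (2 * (i + d))
    exponent d = trans (cong (λ t → suc i * suc i + 2 * t) (ℕP.m+n∸m≡n i d)) (lemma i d)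

q-binomial : ∀ x y M → ∏< M (λ k → x ⊞ y ⊠ q^ (suc (2 * k))) ≈ Σ< (suc M) (binomialTerm M x y)
q-binomial x y zero    = ≈-sym (≈-trans (coeffwise λ N → +ω-identityˡ (binomialTerm 0 x y 0 N))
                                         (⊠-solve 0 (((id ⊗ id) ⊗ id) ⊗ id ⊜ id) ≈-refl))
q-binomial x y (suc M) = begin
  ∏< M F ⊠ f
    ≈⟨ ⊠-cong (q-binomial x y M) ≈-refl ⟩
  Σ< (suc M) T ⊠ f
    ≈⟨ ⊠-comm (Σ< (suc M) T) f ⟩
  f ⊠ Σ< (suc M) T
    ≈⟨ ⊠-distribˡ-Σ< (suc M) f T ⟩
  Σ< (suc M) (λ i → f ⊠ T i)
    ≈⟨ Σ<-cong (suc M) (λ i _ → ≈-trans (⊠-comm f (T i)) (⊠-distribˡ-⊞ (T i) x (y ⊠ Q))) ⟩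
  Σ< (suc M) (λ i → Tx i ⊞ Ty i)
    ≈⟨ Σ<-⊞ (suc M) Tx Ty ⟩
  Σ< (suc M) Tx ⊞ Σ< (suc M) Ty
    ≈⟨ ⊞-cong (≈-trans (Σ<-head M Tx) (⊞-cong Tx0 (≈-trans (≈-sym (⊞-identityʳ _)) (⊞-cong ≈-refl TxLast)))) ≈-refl ⟩
  binomialTerm (suc M) x y 0 ⊞ (Σ< M (λ i → Tx (suc i)) ⊞ Tx (suc M)) ⊞ Σ< (suc M) Ty
    ≈⟨ ≈-trans (⊞-assoc _ _ _) (⊞-cong ≈-refl (⊞-cong (≈-sym (Σ<-last M (λ i → Tx (suc i)))) ≈-refl)) ⟩
  binomialTerm (suc M) x y 0 ⊞ (Σ< (suc M) (λ i → Tx (suc i)) ⊞ Σ< (suc M) Ty)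
    ≈⟨ ⊞-cong ≈-refl (≈-sym (Σ<-⊞ (suc M) (λ i → Tx (suc i)) Ty)) ⟩
  binomialTerm (suc M) x y 0 ⊞ Σ< (suc M) (λ i → Tx (suc i) ⊞ Ty i)
    ≈⟨ ⊞-cong ≈-refl (Σ<-cong (suc M) (λ i i≤M → ≈-sym (binomialTerm-suc M x y i (ℕP.≤-pred i≤M)))) ⟩
  binomialTerm (suc M) x y 0 ⊞ Σ< (suc M) (λ i → binomialTerm (suc M) x y (suc i))
    ≈⟨ Σ<-head (suc M) (binomialTerm (suc M) x y) ⟨
  Σ< (suc (suc M)) (binomialTerm (suc M) x y) ∎
  where
  open ≈-Reasoning
  F = λ k → x ⊞ y ⊠ q^ (suc (2 * k))
  Q = q^ (suc (2 * M))
  f = x ⊞ y ⊠ Q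
  T = binomialTerm M x y
  Tx = λ i → T i ⊠ x
  Ty = λ i → T i ⊠ (y ⊠ Q)
  Tx0 : Tx 0 ≈ binomialTerm (suc M) x y 0
  Tx0 = ⊠-solve 2 (λ a x → (((id ⊗ id) ⊗ a) ⊗ id) ⊗ x ⊜ ((id ⊗ id) ⊗ (x ⊗ a)) ⊗ id) ≈-refl (x ^ M) x
  TxLast : 𝟘 ≈ Tx (suc M)
  TxLast = ≈-sym (≈-trans (⊠-cong (⊠-cong ≈-refl (qbinom-vanish M (suc M) ℕP.≤-refl)) ≈-refl)
                          (≈-trans (⊠-cong (⊠-zeroʳ _) ≈-refl) (⊠-zeroˡ x)))

poch⁻¹ : ℕ → PS
poch⁻¹ n = inv (poch n)

qbinom-poch⁻¹ : ∀ t i → i ≤ t → qbinom t i ⊠ poch⁻¹ t ≈ poch⁻¹ i ⊠ poch⁻¹ (t ∸ i)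
qbinom-poch⁻¹ t i i≤t = begin
  G ⊠ poch⁻¹ t
    ≈⟨ ⊠-identityʳ _ ⟨
  G ⊠ poch⁻¹ t ⊠ one
    ≈⟨ ⊠-cong ≈-refl (≈-trans (⊠-cong (⊠-inverseʳ (ConstTerm1-poch i)) (⊠-inverseʳ (ConstTerm1-poch (t ∸ i)))) (⊠-identityˡ one)) ⟨
  G ⊠ poch⁻¹ t ⊠ ((poch i ⊠ poch⁻¹ i) ⊠ (poch (t ∸ i) ⊠ poch⁻¹ (t ∸ i)))
    ≈⟨ ⊠-solve 6 (λ G It Pi Ii Pj Ij → (G ⊗ It) ⊗ ((Pi ⊗ Ii) ⊗ (Pj ⊗ Ij)) ⊜ (((G ⊗ Pi) ⊗ Pj) ⊗ It) ⊗ (Ii ⊗ Ij)) ≈-refl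
                 G (poch⁻¹ t) (poch i) (poch⁻¹ i) (poch (t ∸ i)) (poch⁻¹ (t ∸ i)) ⟩
  G ⊠ poch i ⊠ poch (t ∸ i) ⊠ poch⁻¹ t ⊠ (poch⁻¹ i ⊠ poch⁻¹ (t ∸ i))
    ≈⟨ ⊠-cong (⊠-cong (qbinom-poch t i i≤t) ≈-refl) ≈-refl ⟩
  poch t ⊠ poch⁻¹ t ⊠ (poch⁻¹ i ⊠ poch⁻¹ (t ∸ i))
    ≈⟨ ⊠-cong (⊠-inverseʳ (ConstTerm1-poch t)) ≈-refl ⟩
  one ⊠ (poch⁻¹ i ⊠ poch⁻¹ (t ∸ i))
    ≈⟨ ⊠-identityˡ _ ⟩
  poch⁻¹ i ⊠ poch⁻¹ (t ∸ i) ∎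
  where
  open ≈-Reasoning
  G = qbinom t i

one-^ : ∀ n → one ^ n ≈ one
one-^ zero    = ≈-refl
one-^ (suc n) = ≈-trans (⊠-identityˡ (one ^ n)) (one-^ n)

sgn : ℕ → PS
sgn s = (⊟ one) ^ s

sgn-+ : ∀ a b → sgn (a + b) ≈ sgn a ⊠ sgn b
sgn-+ = ^-homo-* (⊟ one)

sgn-2* : ∀ a → sgn (2 * a) ≈ one
sgn-2* a = begin
  (⊟ one) ^ (2 * a)     ≈⟨ ^-assocʳ (⊟ one) 2 a ⟨
  ((⊟ one) ^ 2) ^ a     ≈⟨ ^-congˡ a (ring-solve 0 (:- con (+ 1) :* (:- con (+ 1) :* con (+ 1)) := con (+ 1)) ≈-refl) ⟩
  one ^ a               ≈⟨ one-^ a ⟩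
  one                   ∎
  where open ≈-Reasoning

⊟-^ : ∀ a i → (⊟ a) ^ i ≈ sgn i ⊠ a ^ i
⊟-^ a i = ≈-trans (^-congˡ i (ring-solve 1 (λ a → :- a := :- con (+ 1) :* a) ≈-refl a)) (^-distrib-* (⊟ one) a i)

-- Euler's expansion of (q²;q²)_∞ / (q²;q²)_d

alternatingTerm : ℕ → ℕ → PS
alternatingTerm t m = sgn m ⊠ q^ (m * m + m) ⊠ (poch⁻¹ m ⊠ poch⁻¹ (t ∸ m))

-- The q-binomial theorem with x = 1 and y = -q.
Σ<-alternatingTerm : ∀ t → Σ< (suc t) (alternatingTerm t) ≈ one
Σ<-alternatingTerm t = begin
  Σ< (suc t) (alternatingTerm t)
    ≈⟨ Σ<-cong (suc t) (λ i i≤t → ≈-sym (term i (ℕP.≤-pred i≤t))) ⟩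
  Σ< (suc t) (λ i → poch⁻¹ t ⊠ binomialTerm t one y i)
    ≈⟨ ⊠-distribˡ-Σ< (suc t) (poch⁻¹ t) (binomialTerm t one y) ⟨
  poch⁻¹ t ⊠ Σ< (suc t) (binomialTerm t one y)
    ≈⟨ ⊠-cong ≈-refl (q-binomial one y t) ⟨
  poch⁻¹ t ⊠ ∏< t (λ k → one ⊞ y ⊠ q^ (suc (2 * k)))
    ≈⟨ ⊠-cong ≈-refl (∏<-cong t (λ k _ → ⊞-cong ≈-refl (factor k))) ⟩
  poch⁻¹ t ⊠ poch t
    ≈⟨ ⊠-inverseˡ (ConstTerm1-poch t) ⟩
  one ∎
  where
  open ≈-Reasoning
  y = ⊟ q^ 1
  factor : ∀ k → y ⊠ q^ (suc (2 * k)) ≈ ⊟ q^ (2 * suc k)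
  factor k = ≈-trans (ring-solve 2 (λ a b → :- a :* b := :- (a :* b)) ≈-refl (q^ 1) (q^ (suc (2 * k))))
                     (⊟-cong (≈-trans (≈-sym (q^-+ 1 (suc (2 * k)))) (q^-≡ (lemma k))))
    where
    lemma : ∀ k → 1 + suc (2 * k) ≡ 2 * suc k
    lemma = solve-∀
  term : ∀ i → i ≤ t → poch⁻¹ t ⊠ binomialTerm t one y i ≈ alternatingTerm t i
  term i i≤t = begin
    poch⁻¹ t ⊠ (q^ (i * i) ⊠ y ^ i ⊠ one ^ (t ∸ i) ⊠ qbinom t i)
      ≈⟨ ⊠-cong ≈-refl (⊠-cong (⊠-cong (⊠-cong ≈-refl (⊟-^ (q^ 1) i)) (one-^ (t ∸ i))) ≈-refl) ⟩
    poch⁻¹ t ⊠ (q^ (i * i) ⊠ (sgn i ⊠ q^ 1 ^ i) ⊠ one ⊠ qbinom t i)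
      ≈⟨ ⊠-solve 5 (λ P Q s Y G → P ⊗ (((Q ⊗ (s ⊗ Y)) ⊗ id) ⊗ G) ⊜ (s ⊗ (Q ⊗ Y)) ⊗ (G ⊗ P)) ≈-refl
                   (poch⁻¹ t) (q^ (i * i)) (sgn i) (q^ 1 ^ i) (qbinom t i) ⟩
    sgn i ⊠ (q^ (i * i) ⊠ q^ 1 ^ i) ⊠ (qbinom t i ⊠ poch⁻¹ t)
      ≈⟨ ⊠-cong (⊠-cong ≈-refl (≈-trans (⊠-cong ≈-refl (q^-* 1 i))
                  (≈-trans (≈-sym (q^-+ (i * i) (1 * i))) (q^-≡ (cong (λ e → i * i + e) (ℕP.*-identityˡ i))))))
                (qbinom-poch⁻¹ t i i≤t) ⟩
    alternatingTerm t i ∎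

qPoch-q²≈poch : ∀ n → qPoch (pow X 2) (pow X 2) n ≈ poch n
qPoch-q²≈poch n = ≈-trans (qPoch≈∏< (pow X 2) (pow X 2) n) (∏<-cong n λ k _ → ⊞-cong ≈-refl (⊟-cong (begin
  pow X 2 ⊠ pow X 2 ^ k   ≈⟨ ⊠-cong (pow≈^ X 2) (^-congˡ k (pow≈^ X 2)) ⟩
  q^ 2 ⊠ q^ 2 ^ k         ≈⟨ ⊠-cong ≈-refl (q^-* 2 k) ⟩
  q^ 2 ⊠ q^ (2 * k)       ≈⟨ q^-+ 2 (2 * k) ⟨
  q^ (2 + 2 * k)          ≈⟨ q^-≡ (sym (ℕP.*-distribˡ-+ 2 1 k)) ⟩
  q^ (2 * suc k)          ∎)))
  where open ≈-Reasoning

poch∞ : PS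
poch∞ = qPochInf (pow X 2) (pow X 2)

poch-≈[] : ∀ n d → poch (n + d) ≈[ suc n ] poch n
poch-≈[] n zero    = coeffwise< λ N _ → cong (λ t → poch t N) (ℕP.+-identityʳ n)
poch-≈[] n (suc d) = begin
  poch (n + suc d)                                        ≈⟨ ≈⇒≈[] _ (coeffwise λ N → cong (λ t → poch t N) (ℕP.+-suc n d)) ⟩
  poch (n + d) ⊠ (one ⊞ ⊟ q^ (2 * suc (n + d)))           ≈⟨ ⊠-cong-≈[] (suc n) (poch-≈[] n d) factor≈one ⟩
  poch n ⊠ one                                            ≈⟨ ≈⇒≈[] _ (⊠-identityʳ (poch n)) ⟩
  poch n                                                  ∎
  where
  open ≈[]-Reasoning (suc n)
  1+n≤2[1+n+d] : suc n ≤ 2 * suc (n + d)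
  1+n≤2[1+n+d] = ℕP.≤-trans (s≤s (ℕP.m≤m+n n d)) (ℕP.m≤m+n (suc (n + d)) (suc (n + d) + 0))
  factor≈one : one ⊞ ⊟ q^ (2 * suc (n + d)) ≈[ suc n ] one
  factor≈one = begin
    one ⊞ ⊟ q^ (2 * suc (n + d)) ≈⟨ ⊞-cong-≈[] (suc n) ≈[]-refl
                                     (q^∣⇒≈[]𝟘 (q^∣-mono 1+n≤2[1+n+d] (q^∣-⊟ (q^∣q^ (2 * suc (n + d)))))) ⟩
    one ⊞ 𝟘                       ≈⟨ ≈⇒≈[] _ (⊞-identityʳ one) ⟩
    one                           ∎

poch∞-≈[] : ∀ K → poch∞ ≈[ K ] poch K
poch∞-≈[] K = coeffwise< λ N N<K → begin
  qPoch (pow X 2) (pow X 2) N N ≡⟨ coeff (qPoch-q²≈poch N) N ⟩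
  poch N N                      ≡⟨ sym (coeff< (poch-≈[] N (K ∸ N)) N ℕP.≤-refl) ⟩
  poch (N + (K ∸ N)) N          ≡⟨ cong (λ t → poch t N) (ℕP.m+[n∸m]≡n (ℕP.<⇒≤ N<K)) ⟩
  poch K N                      ∎
  where open ≡-Reasoning

eulerTerm : ℕ → ℕ → PS
eulerTerm d s = sgn s ⊠ q^ (s * s + s + 2 * d * s) ⊠ poch⁻¹ s

eulerSum : ℕ → PS
eulerSum d = sumSeries (eulerTerm d)

q^∣-eulerTerm : ∀ d s → q^ (s * s + s + 2 * d * s) ∣ eulerTerm d s
q^∣-eulerTerm d s = q^∣-⊠ˡ (poch⁻¹ s) (q^∣-⊠ʳ (sgn s) (q^∣q^ _))

eulerTerm-summable : ∀ d → Summable (eulerTerm d)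
eulerTerm-summable d s = q^∣-mono s≤e (q^∣-eulerTerm d s)
  where
  s≤e : s ≤ s * s + s + 2 * d * s
  s≤e = ℕP.≤-trans (ℕP.m≤n+m s (s * s)) (ℕP.m≤m+n (s * s + s) (2 * d * s))

poch⁻¹-suc : ∀ s → poch⁻¹ s ≈ poch⁻¹ (suc s) ⊠ (one ⊞ ⊟ q^ (2 * suc s))
poch⁻¹-suc s = ≈-sym (inv-unique (ConstTerm1-poch s) (begin
  poch s ⊠ (poch⁻¹ (suc s) ⊠ F) ≈⟨ ⊠-solve 3 (λ P I F → P ⊗ (I ⊗ F) ⊜ (P ⊗ F) ⊗ I) ≈-refl (poch s) (poch⁻¹ (suc s)) F ⟩
  poch (suc s) ⊠ poch⁻¹ (suc s) ≈⟨ ⊠-inverseʳ (ConstTerm1-poch (suc s)) ⟩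
  one                           ∎))
  where
  open ≈-Reasoning
  F = one ⊞ ⊟ q^ (2 * suc s)

eulerTerm-suc : ∀ d s → eulerTerm d (suc s) ≈ eulerTerm (suc d) (suc s) ⊞ ⊟ (q^ (2 * suc d) ⊠ eulerTerm (suc d) s)
eulerTerm-suc d s = ≈-sym (begin
  σ ⊠ q^ E₁ ⊠ I ⊞ ⊟ (q^ (2 * suc d) ⊠ (sgn s ⊠ q^ E₃ ⊠ poch⁻¹ s))
    ≈⟨ ⊞-cong (⊠-cong (⊠-cong ≈-refl (≈-trans (q^-≡ E₁≡E+B) (q^-+ E (2 * suc s)))) ≈-refl)
              (⊟-cong (⊠-cong ≈-refl (⊠-cong ≈-refl (poch⁻¹-suc s)))) ⟩
  σ ⊠ (q^ E ⊠ B) ⊠ I ⊞ ⊟ (q^ (2 * suc d) ⊠ (sgn s ⊠ q^ E₃ ⊠ (I ⊠ (one ⊞ ⊟ B))))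
    ≈⟨ ⊞-cong ≈-refl (⊟-cong (⊠-solve 5 (λ D s e I F → D ⊗ ((s ⊗ e) ⊗ (I ⊗ F)) ⊜ ((s ⊗ (e ⊗ D)) ⊗ I) ⊗ F) ≈-refl
                                       (q^ (2 * suc d)) (sgn s) (q^ E₃) I (one ⊞ ⊟ B))) ⟩
  σ ⊠ (q^ E ⊠ B) ⊠ I ⊞ ⊟ (sgn s ⊠ (q^ E₃ ⊠ q^ (2 * suc d)) ⊠ I ⊠ (one ⊞ ⊟ B))
    ≈⟨ ⊞-cong ≈-refl (⊟-cong (⊠-cong (⊠-cong (⊠-cong ≈-refl (≈-trans (≈-sym (q^-+ E₃ (2 * suc d))) (q^-≡ E₃+2[1+d]≡E))) ≈-refl) ≈-refl)) ⟩
  σ ⊠ (q^ E ⊠ B) ⊠ I ⊞ ⊟ (sgn s ⊠ q^ E ⊠ I ⊠ (one ⊞ ⊟ B))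
    ≈⟨ ring-solve 4 (λ s e B I → :- con (+ 1) :* s :* (e :* B) :* I :+ :- (s :* e :* I :* (con (+ 1) :+ :- B))
                              := :- con (+ 1) :* s :* e :* I) ≈-refl (sgn s) (q^ E) B I ⟩
  eulerTerm d (suc s) ∎)
  where
  open ≈-Reasoning
  σ = sgn (suc s)
  I = poch⁻¹ (suc s)
  B = q^ (2 * suc s)
  E = suc s * suc s + suc s + 2 * d * suc s
  E₁ = suc s * suc s + suc s + 2 * suc d * suc s
  E₃ = s * s + s + 2 * suc d * s
  E₁≡E+B : E₁ ≡ E + 2 * suc s
  E₁≡E+B = lemma s d
    where
    lemma : ∀ s d → suc s * suc s + suc s + 2 * suc d * suc s ≡ suc s * suc s + suc s + 2 * d * suc s + 2 * suc s
    lemma = solve-∀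
  E₃+2[1+d]≡E : E₃ + 2 * suc d ≡ E
  E₃+2[1+d]≡E = lemma s d
    where
    lemma : ∀ s d → s * s + s + 2 * suc d * s + 2 * suc d ≡ suc s * suc s + suc s + 2 * d * suc s
    lemma = solve-∀

Σ<-recurrence : ∀ Q F G K → F 0 ≈ G 0 → (∀ s → F (suc s) ≈ G (suc s) ⊞ ⊟ (Q ⊠ G s)) →
                Σ< (suc K) F ≈ Σ< (suc K) G ⊞ ⊟ (Q ⊠ Σ< K G)
Σ<-recurrence Q F G K F₀≈G₀ F-suc = begin
  Σ< (suc K) F
    ≈⟨ Σ<-head K F ⟩
  F 0 ⊞ Σ< K (λ s → F (suc s))
    ≈⟨ ⊞-cong F₀≈G₀ (Σ<-cong K (λ s _ → F-suc s)) ⟩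
  G 0 ⊞ Σ< K (λ s → G (suc s) ⊞ ⊟ (Q ⊠ G s))
    ≈⟨ ⊞-cong ≈-refl (≈-trans (Σ<-⊞ K _ _) (⊞-cong ≈-refl (Σ<-⊟ K (λ s → Q ⊠ G s)))) ⟩
  G 0 ⊞ (Σ< K (λ s → G (suc s)) ⊞ ⊟ Σ< K (λ s → Q ⊠ G s))
    ≈⟨ ⊞-assoc _ _ _ ⟨
  G 0 ⊞ Σ< K (λ s → G (suc s)) ⊞ ⊟ Σ< K (λ s → Q ⊠ G s)
    ≈⟨ ⊞-cong (Σ<-head K G) (⊟-cong (⊠-distribˡ-Σ< K Q G)) ⟨
  Σ< (suc K) G ⊞ ⊟ (Q ⊠ Σ< K G) ∎
  where open ≈-Reasoning

sumSeries-recurrence : ∀ Q F G → Summable F → Summable G → F 0 ≈ G 0 →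
                       (∀ s → F (suc s) ≈ G (suc s) ⊞ ⊟ (Q ⊠ G s)) →
                       sumSeries F ≈ (one ⊞ ⊟ Q) ⊠ sumSeries G
sumSeries-recurrence Q F G F-summable G-summable F₀≈G₀ F-suc = ≈[]-all⇒≈ λ K → let open ≈[]-Reasoning K in begin
  sumSeries F
    ≈⟨ ≈[]-mono (ℕP.n≤1+n K) (sumSeries-≈[]-Σ< (suc K) F F-summable) ⟩
  Σ< (suc K) F
    ≈⟨ ≈⇒≈[] K (Σ<-recurrence Q F G K F₀≈G₀ F-suc) ⟩
  Σ< (suc K) G ⊞ ⊟ (Q ⊠ Σ< K G)
    ≈⟨ ⊞-cong-≈[] K (≈[]-mono (ℕP.n≤1+n K) (sumSeries-≈[]-Σ< (suc K) G G-summable))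
                    (⊟-cong-≈[] K (⊠-cong-≈[] K ≈[]-refl (sumSeries-≈[]-Σ< K G G-summable))) ⟨
  sumSeries G ⊞ ⊟ (Q ⊠ sumSeries G)
    ≈⟨ ≈⇒≈[] K (ring-solve 2 (λ S Q → S :+ :- (Q :* S) := (con (+ 1) :+ :- Q) :* S) ≈-refl (sumSeries G) Q) ⟩
  (one ⊞ ⊟ Q) ⊠ sumSeries G ∎

eulerTerm-zero : ∀ d → eulerTerm d 0 ≈ one
eulerTerm-zero d = begin
  one ⊠ q^ (2 * d * 0) ⊠ poch⁻¹ 0  ≈⟨ ⊠-cong (⊠-cong ≈-refl (q^-≡ (ℕP.*-zeroʳ (2 * d)))) (inv-one) ⟩
  one ⊠ one ⊠ one                  ≈⟨ ⊠-solve 0 ((id ⊗ id) ⊗ id ⊜ id) ≈-refl ⟩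
  one                              ∎
  where
  open ≈-Reasoning
  inv-one : poch⁻¹ 0 ≈ one
  inv-one = ≈-sym (inv-unique refl (⊠-identityˡ one))

eulerSum-suc : ∀ d → eulerSum d ≈ (one ⊞ ⊟ q^ (2 * suc d)) ⊠ eulerSum (suc d)
eulerSum-suc d = sumSeries-recurrence (q^ (2 * suc d)) (eulerTerm d) (eulerTerm (suc d))
  (eulerTerm-summable d) (eulerTerm-summable (suc d))
  (≈-trans (eulerTerm-zero d) (≈-sym (eulerTerm-zero (suc d)))) (eulerTerm-suc d)

eulerSum-≈[]-one : ∀ d → eulerSum d ≈[ suc d ] one
eulerSum-≈[]-one d = begin
  eulerSum d
    ≈⟨ ≈[]-mono (ℕP.n≤1+n (suc d)) (sumSeries-≈[]-Σ< (suc (suc d)) (eulerTerm d) (eulerTerm-summable d)) ⟩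
  Σ< (suc (suc d)) (eulerTerm d)
    ≈⟨ ≈⇒≈[] _ (Σ<-head (suc d) (eulerTerm d)) ⟩
  eulerTerm d 0 ⊞ Σ< (suc d) (λ s → eulerTerm d (suc s))
    ≈⟨ ⊞-cong-≈[] (suc d) (≈⇒≈[] _ (eulerTerm-zero d))
         (q^∣⇒≈[]𝟘 (q^∣-Σ< (suc d) _ (λ s _ → q^∣-mono (1+d≤exponent s) (q^∣-eulerTerm d (suc s))))) ⟩
  one ⊞ 𝟘
    ≈⟨ ≈⇒≈[] _ (⊞-identityʳ one) ⟩
  one ∎
  where
  open ≈[]-Reasoning (suc d)
  1+d≤exponent : ∀ s → suc d ≤ suc s * suc s + suc s + 2 * d * suc s
  1+d≤exponent s = subst (suc d ≤_) (lemma s d) (ℕP.m≤m+n (suc d) (s * s + 3 * s + 1 + 2 * d * s + d))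
    where
    lemma : ∀ s d → suc d + (s * s + 3 * s + 1 + 2 * d * s + d) ≡ suc s * suc s + suc s + 2 * d * suc s
    lemma = solve-∀

-- eulerSum d · (q²;q²)_d does not depend on d by eulerSum-suc, and for d = K it agrees with
-- (q²;q²)_∞ below degree K.
eulerSum-⊠-poch : ∀ d → eulerSum d ⊠ poch d ≈ poch∞
eulerSum-⊠-poch d = ≈-trans (≈-sym (invariant d)) (≈[]-all⇒≈ λ K → let open ≈[]-Reasoning K in begin
  eulerSum 0 ⊠ poch 0    ≈⟨ ≈⇒≈[] K (invariant K) ⟩
  eulerSum K ⊠ poch K    ≈⟨ ≈[]-mono (ℕP.n≤1+n K) (⊠-cong-≈[] (suc K) (eulerSum-≈[]-one K) ≈[]-refl) ⟩
  one ⊠ poch K           ≈⟨ ≈⇒≈[] K (⊠-identityˡ (poch K)) ⟩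
  poch K                 ≈⟨ poch∞-≈[] K ⟨
  poch∞                  ∎)
  where
  invariant : ∀ d → eulerSum 0 ⊠ poch 0 ≈ eulerSum d ⊠ poch d
  invariant zero    = ≈-refl
  invariant (suc d) = ≈-trans (invariant d) (≈-trans (⊠-cong (eulerSum-suc d) ≈-refl)
    (⊠-solve 3 (λ F S P → (F ⊗ S) ⊗ P ⊜ S ⊗ (P ⊗ F)) ≈-refl (one ⊞ ⊟ q^ (2 * suc d)) (eulerSum (suc d)) (poch d)))

euler : ∀ d → poch∞ ⊠ poch⁻¹ d ≈ eulerSum d
euler d = begin
  poch∞ ⊠ poch⁻¹ d                    ≈⟨ ⊠-cong (eulerSum-⊠-poch d) ≈-refl ⟨
  eulerSum d ⊠ poch d ⊠ poch⁻¹ d      ≈⟨ ⊠-assoc _ _ _ ⟩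
  eulerSum d ⊠ (poch d ⊠ poch⁻¹ d)    ≈⟨ ⊠-cong ≈-refl (⊠-inverseʳ (ConstTerm1-poch d)) ⟩
  eulerSum d ⊠ one                    ≈⟨ ⊠-identityʳ _ ⟩
  eulerSum d                          ∎
  where open ≈-Reasoning

-- A partial theta identity

doubleTerm : ℕ → ℕ → PS
doubleTerm k m = q^ (2 * (m * m + m + k * m)) ⊠ (poch⁻¹ m ⊠ poch⁻¹ (m + k))

thetaTerm : ℕ → ℕ → PS
thetaTerm k r = sgn r ⊠ q^ (r * r + r + 2 * k * r)

m≤2[m*m+m+k*m] : ∀ k m → m ≤ 2 * (m * m + m + k * m)
m≤2[m*m+m+k*m] k m = ℕP.≤-trans (ℕP.m≤n+m m (m * m))
  (ℕP.≤-trans (ℕP.m≤m+n (m * m + m) (k * m)) (ℕP.m≤m+n (m * m + m + k * m) (m * m + m + k * m + 0)))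

doubleTerm-summable : ∀ k → Summable (doubleTerm k)
doubleTerm-summable k m = q^∣-mono (m≤2[m*m+m+k*m] k m) (q^∣q^-⊠ _ _)

thetaTerm-summable : ∀ k → Summable (thetaTerm k)
thetaTerm-summable k r = q^∣-mono r≤e (q^∣-⊠ʳ (sgn r) (q^∣q^ _))
  where
  r≤e : r ≤ r * r + r + 2 * k * r
  r≤e = ℕP.≤-trans (ℕP.m≤n+m r (r * r)) (ℕP.m≤m+n (r * r + r) (2 * k * r))

sgn-square : ∀ a → sgn a ⊠ sgn a ≈ one
sgn-square a = ≈-trans (≈-sym (sgn-+ a a)) (≈-trans (coeffwise λ N → cong (λ t → sgn t N) (a+a≡2a a)) (sgn-2* a))
  where
  a+a≡2a : ∀ a → a + a ≡ 2 * a
  a+a≡2a = solve-∀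

eulerProductTerm : ℕ → ℕ → ℕ → PS
eulerProductTerm k m s = q^ (2 * (m * m + m + k * m)) ⊠ poch⁻¹ m ⊠ eulerTerm (m + k) s

eulerProductTerm-factors : ∀ k m s → eulerProductTerm k m s ≈ thetaTerm k (m + s) ⊠ alternatingTerm (m + s) m
eulerProductTerm-factors k m s = begin
  q^ A ⊠ poch⁻¹ m ⊠ (sgn s ⊠ q^ B ⊠ poch⁻¹ s)
    ≈⟨ ⊠-solve 5 (λ a I σ b J → (a ⊗ I) ⊗ ((σ ⊗ b) ⊗ J) ⊜ (σ ⊗ (a ⊗ b)) ⊗ (I ⊗ J)) ≈-refl
                 (q^ A) (poch⁻¹ m) (sgn s) (q^ B) (poch⁻¹ s) ⟩
  sgn s ⊠ (q^ A ⊠ q^ B) ⊠ (poch⁻¹ m ⊠ poch⁻¹ s)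
    ≈⟨ ⊠-cong (⊠-cong sgn-s (≈-trans (≈-sym (q^-+ A B)) (≈-trans (q^-≡ (exponent k m s)) (q^-+ C D))))
              (⊠-cong ≈-refl (coeffwise λ N → cong (λ t → poch⁻¹ t N) (sym (ℕP.m+n∸m≡n m s)))) ⟩
  sgn (m + s) ⊠ sgn m ⊠ (q^ C ⊠ q^ D) ⊠ (poch⁻¹ m ⊠ poch⁻¹ (m + s ∸ m))
    ≈⟨ ⊠-solve 5 (λ σ τ c d I → ((σ ⊗ τ) ⊗ (c ⊗ d)) ⊗ I ⊜ (σ ⊗ c) ⊗ ((τ ⊗ d) ⊗ I)) ≈-refl
                 (sgn (m + s)) (sgn m) (q^ C) (q^ D) (poch⁻¹ m ⊠ poch⁻¹ (m + s ∸ m)) ⟩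
  thetaTerm k (m + s) ⊠ alternatingTerm (m + s) m ∎
  where
  open ≈-Reasoning
  A = 2 * (m * m + m + k * m)
  B = s * s + s + 2 * (m + k) * s
  C = (m + s) * (m + s) + (m + s) + 2 * k * (m + s)
  D = m * m + m
  exponent : ∀ k m s → 2 * (m * m + m + k * m) + (s * s + s + 2 * (m + k) * s)
                     ≡ (m + s) * (m + s) + (m + s) + 2 * k * (m + s) + (m * m + m)
  exponent = solve-∀
  sgn-s : sgn s ≈ sgn (m + s) ⊠ sgn m
  sgn-s = ≈-sym (begin
    sgn (m + s) ⊠ sgn m      ≈⟨ ⊠-cong (sgn-+ m s) ≈-refl ⟩
    sgn m ⊠ sgn s ⊠ sgn m    ≈⟨ ⊠-solve 2 (λ a b → (a ⊗ b) ⊗ a ⊜ (a ⊗ a) ⊗ b) ≈-refl (sgn m) (sgn s) ⟩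
    sgn m ⊠ sgn m ⊠ sgn s    ≈⟨ ⊠-cong (sgn-square m) ≈-refl ⟩
    one ⊠ sgn s              ≈⟨ ⊠-identityˡ (sgn s) ⟩
    sgn s                    ∎)

poch∞-⊠-doubleTerm : ∀ k m → poch∞ ⊠ doubleTerm k m ≈ q^ (2 * (m * m + m + k * m)) ⊠ poch⁻¹ m ⊠ eulerSum (m + k)
poch∞-⊠-doubleTerm k m =
  ≈-trans (⊠-solve 4 (λ P a I J → P ⊗ (a ⊗ (I ⊗ J)) ⊜ (a ⊗ I) ⊗ (P ⊗ J)) ≈-refl
                     poch∞ (q^ (2 * (m * m + m + k * m))) (poch⁻¹ m) (poch⁻¹ (m + k)))
          (⊠-cong ≈-refl (euler (m + k)))

eulerProductTerm-ord : ∀ k m s → q^ (m + s) ∣ eulerProductTerm k m s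
eulerProductTerm-ord k m s =
  q^∣-⊠ m s (q^∣-⊠ˡ (poch⁻¹ m) (q^∣-mono (m≤2[m*m+m+k*m] k m) (q^∣q^ _))) (eulerTerm-summable (m + k) s)

Σ<-eulerProductTerm-antidiagonal : ∀ k t → Σ< (suc t) (λ m → eulerProductTerm k m (t ∸ m)) ≈ thetaTerm k t
Σ<-eulerProductTerm-antidiagonal k t = begin
  Σ< (suc t) (λ m → eulerProductTerm k m (t ∸ m))
    ≈⟨ Σ<-cong (suc t) (λ m m≤t → term m (ℕP.≤-pred m≤t)) ⟩
  Σ< (suc t) (λ m → thetaTerm k t ⊠ alternatingTerm t m)
    ≈⟨ ⊠-distribˡ-Σ< (suc t) (thetaTerm k t) (alternatingTerm t) ⟨
  thetaTerm k t ⊠ Σ< (suc t) (alternatingTerm t)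
    ≈⟨ ⊠-cong ≈-refl (Σ<-alternatingTerm t) ⟩
  thetaTerm k t ⊠ one
    ≈⟨ ⊠-identityʳ _ ⟩
  thetaTerm k t ∎
  where
  open ≈-Reasoning
  term : ∀ m → m ≤ t → eulerProductTerm k m (t ∸ m) ≈ thetaTerm k t ⊠ alternatingTerm t m
  term m m≤t = ≤-+-elim (λ t → eulerProductTerm k m (t ∸ m) ≈ thetaTerm k t ⊠ alternatingTerm t m) m≤t λ s →
    ≈-trans (coeffwise λ N → cong (λ u → eulerProductTerm k m u N) (ℕP.m+n∸m≡n m s))
            (eulerProductTerm-factors k m s)

-- Expand (q²;q²)_∞ / (q²;q²)_{m+k} by Euler's identity, collect the terms of the resulting double
-- sum along the antidiagonals m + s = t, and sum each of them with Σ<-alternatingTerm.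
theta-identity : ∀ k → poch∞ ⊠ sumSeries (doubleTerm k) ≈ sumSeries (thetaTerm k)
theta-identity k = ≈[]-all⇒≈ λ K → let open ≈[]-Reasoning K in begin
  poch∞ ⊠ sumSeries (doubleTerm k)
    ≈⟨ ⊠-cong-≈[] K ≈[]-refl (sumSeries-≈[]-Σ< K (doubleTerm k) (doubleTerm-summable k)) ⟩
  poch∞ ⊠ Σ< K (doubleTerm k)
    ≈⟨ ≈⇒≈[] K (≈-trans (⊠-distribˡ-Σ< K poch∞ (doubleTerm k)) (Σ<-cong K (λ m _ → poch∞-⊠-doubleTerm k m))) ⟩
  Σ< K (λ m → q^ (2 * (m * m + m + k * m)) ⊠ poch⁻¹ m ⊠ eulerSum (m + k))
    ≈⟨ Σ<-cong-≈[] K K (λ m _ → ⊠-cong-≈[] K ≈[]-refl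
                         (sumSeries-≈[]-Σ< K (eulerTerm (m + k)) (eulerTerm-summable (m + k)))) ⟩
  Σ< K (λ m → q^ (2 * (m * m + m + k * m)) ⊠ poch⁻¹ m ⊠ Σ< K (eulerTerm (m + k)))
    ≈⟨ ≈⇒≈[] K (Σ<-cong K (λ m _ → ⊠-distribˡ-Σ< K _ (eulerTerm (m + k)))) ⟩
  Σ< K (λ m → Σ< K (eulerProductTerm k m))
    ≈⟨ Σ<-Σ<-antidiagonal K (eulerProductTerm k) (eulerProductTerm-ord k) ⟩
  Σ< K (λ t → Σ< (suc t) (λ m → eulerProductTerm k m (t ∸ m)))
    ≈⟨ ≈⇒≈[] K (Σ<-cong K (λ t _ → Σ<-eulerProductTerm-antidiagonal k t)) ⟩
  Σ< K (thetaTerm k)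
    ≈⟨ sumSeries-≈[]-Σ< K (thetaTerm k) (thetaTerm-summable k) ⟨
  sumSeries (thetaTerm k) ∎

infix 25 ω^_
ω^_ : ℕ → ℤω
ω^ zero    = 1ω
ω^ (suc a) = ω^ a *ω ω

ω^-+ : ∀ a b → ω^ (a + b) ≡ ω^ a *ω ω^ b
ω^-+ a zero    = trans (cong ω^_ (ℕP.+-identityʳ a)) (sym (*ω-identityʳ (ω^ a)))
ω^-+ a (suc b) = trans (cong ω^_ (ℕP.+-suc a b)) (trans (cong (_*ω ω) (ω^-+ a b)) (*ω-assoc (ω^ a) (ω^ b) ω))

ω^-*3 : ∀ a → ω^ (a * 3) ≡ 1ω
ω^-*3 zero    = refl
ω^-*3 (suc a) = trans (ω^-+ 3 (a * 3)) (cong (ω^ 3 *ω_) (ω^-*3 a))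

ω^-+*3 : ∀ a b → ω^ (a + b * 3) ≡ ω^ a
ω^-+*3 a b = trans (ω^-+ a (b * 3)) (trans (cong (ω^ a *ω_) (ω^-*3 b)) (*ω-identityʳ (ω^ a)))

ω^-%3 : ∀ a → ω^ a ≡ ω^ (a % 3)
ω^-%3 a = trans (cong ω^_ (m≡m%n+[m/n]*n a 3)) (ω^-+*3 (a % 3) (a / 3))

expOmega-+ : ∀ j → expOmega (+ j) ≡ ω^ j
expOmega-+ j rewrite ω^-%3 j with j % 3 | m%n<n j 3
... | 0 | _ = refl
... | 1 | _ = refl
... | 2 | _ = refl
... | suc (suc (suc _)) | s≤s (s≤s (s≤s ()))

-- -[1+ j ] %ℕ 3 is computed from suc j % 3.
expOmega-neg : ∀ j → expOmega -[1+ j ] ≡ ω^ (2 * suc j)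
expOmega-neg j = sym (begin
  ω^ (suc j + (suc j + 0))         ≡⟨ ω^-+ (suc j) (suc j + 0) ⟩
  ω^ (suc j) *ω ω^ (suc j + 0)     ≡⟨ cong₂ _*ω_ (ω^-%3 (suc j)) (trans (cong ω^_ (ℕP.+-identityʳ (suc j))) (ω^-%3 (suc j))) ⟩
  ω^ r *ω ω^ r                     ≡⟨ square (m%n<n (suc j) 3) ⟩
  expOmega -[1+ j ]                ∎)
  where
  open ≡-Reasoning
  r = suc j % 3
  square : r < 3 → ω^ r *ω ω^ r ≡ expOmega -[1+ j ]
  square r<3 with suc j % 3 | r<3
  ... | 0 | _ = refl
  ... | 1 | _ = refl
  ... | 2 | _ = refl
  ... | suc (suc (suc _)) | s≤s (s≤s (s≤s ()))

-- ω^j + ω^{-j}, with the single term for j = 0 counted once.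
ω^± : ℕ → ℤω
ω^± zero    = 1ω
ω^± (suc j) = ω^ (suc j) +ω ω^ (2 * suc j)

const-ω-^ : ∀ i → const ω ^ i ≈ const (ω^ i)
const-ω-^ zero    = ≈-refl
const-ω-^ (suc i) = ≈-trans (⊠-cong ≈-refl (const-ω-^ i)) (≈-trans (const-⊠ ω (ω^ i)) (const-≡ (*ω-comm ω (ω^ i))))

-- The left-hand side

poch-odd : ℤω → ℕ → PS
poch-odd c n = ∏< n (λ k → one ⊞ const c ⊠ q^ (suc (2 * k)))

one⊞cube-factors : ∀ Y → one ⊞ Y ⊠ Y ⊠ Y ≈ (one ⊞ one ⊠ Y) ⊠ ((one ⊞ const ω ⊠ Y) ⊠ (one ⊞ const (ω^ 2) ⊠ Y))
one⊞cube-factors Y = ≈-sym (begin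
  (one ⊞ one ⊠ Y) ⊠ ((one ⊞ a ⊠ Y) ⊠ (one ⊞ b ⊠ Y))
    ≈⟨ ring-solve 3 (λ a b Y → (con (+ 1) :+ con (+ 1) :* Y) :* ((con (+ 1) :+ a :* Y) :* (con (+ 1) :+ b :* Y))
                             := con (+ 1) :+ (con (+ 1) :+ a :+ b) :* Y :+ (a :+ b :+ a :* b) :* (Y :* Y) :+ a :* b :* (Y :* Y :* Y))
                    ≈-refl a b Y ⟩
  one ⊞ (one ⊞ a ⊞ b) ⊠ Y ⊞ (a ⊞ b ⊞ a ⊠ b) ⊠ (Y ⊠ Y) ⊞ a ⊠ b ⊠ (Y ⊠ Y ⊠ Y)
    ≈⟨ ⊞-cong (⊞-cong (⊞-cong ≈-refl (⊠-cong 1+ω+ω²≈0 ≈-refl)) (⊠-cong ω+ω²+ω³≈0 ≈-refl)) (⊠-cong ω³≈1 ≈-refl) ⟩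
  one ⊞ 𝟘 ⊠ Y ⊞ 𝟘 ⊠ (Y ⊠ Y) ⊞ one ⊠ (Y ⊠ Y ⊠ Y)
    ≈⟨ ring-solve 1 (λ Y → con (+ 1) :+ con (+ 0) :* Y :+ con (+ 0) :* (Y :* Y) :+ con (+ 1) :* (Y :* Y :* Y)
                         := con (+ 1) :+ Y :* Y :* Y) ≈-refl Y ⟩
  one ⊞ Y ⊠ Y ⊠ Y ∎)
  where
  open ≈-Reasoning
  a = const ω
  b = const (ω^ 2)
  1+ω+ω²≈0 : one ⊞ a ⊞ b ≈ 𝟘
  1+ω+ω²≈0 = ≈-trans (⊞-cong (const-⊞ 1ω ω) ≈-refl) (const-⊞ (1ω +ω ω) (ω^ 2))
  ω+ω²+ω³≈0 : a ⊞ b ⊞ a ⊠ b ≈ 𝟘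
  ω+ω²+ω³≈0 = ≈-trans (⊞-cong (const-⊞ ω (ω^ 2)) (const-⊠ ω (ω^ 2))) (const-⊞ (ω +ω ω^ 2) (ω *ω ω^ 2))
  ω³≈1 : a ⊠ b ≈ one
  ω³≈1 = const-⊠ ω (ω^ 2)

one⊞⊟[neg-⊠] : ∀ a b → one ⊞ ⊟ (neg a ⊠ b) ≈ one ⊞ a ⊠ b
one⊞⊟[neg-⊠] a b = ⊞-cong ≈-refl (≈-trans (⊟-cong (⊠-cong (neg≈⊟ a) ≈-refl))
                     (ring-solve 2 (λ a b → :- (:- a :* b) := a :* b) ≈-refl a b))

qPoch-q³-q⁶ : ∀ n → qPoch (neg (pow X 3)) (pow X 6) n ≈ poch-odd 1ω n ⊠ (poch-odd ω n ⊠ poch-odd (ω^ 2) n)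
qPoch-q³-q⁶ n = begin
  qPoch (neg (pow X 3)) (pow X 6) n
    ≈⟨ qPoch≈∏< (neg (pow X 3)) (pow X 6) n ⟩
  ∏< n (λ k → one ⊞ ⊟ (neg (pow X 3) ⊠ pow X 6 ^ k))
    ≈⟨ ∏<-cong n (λ k _ → ≈-trans (one⊞⊟[neg-⊠] (pow X 3) (pow X 6 ^ k)) (≈-trans (⊞-cong ≈-refl (cube k)) (one⊞cube-factors _))) ⟩
  ∏< n (λ k → (one ⊞ one ⊠ Y k) ⊠ ((one ⊞ const ω ⊠ Y k) ⊠ (one ⊞ const (ω^ 2) ⊠ Y k)))
    ≈⟨ ≈-trans (∏<-⊠ n _ _) (⊠-cong ≈-refl (∏<-⊠ n _ _)) ⟩
  poch-odd 1ω n ⊠ (poch-odd ω n ⊠ poch-odd (ω^ 2) n) ∎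
  where
  open ≈-Reasoning
  Y : ℕ → PS
  Y k = q^ (suc (2 * k))
  cube : ∀ k → pow X 3 ⊠ pow X 6 ^ k ≈ Y k ⊠ Y k ⊠ Y k
  cube k = begin
    pow X 3 ⊠ pow X 6 ^ k       ≈⟨ ⊠-cong (pow≈^ X 3) (≈-trans (^-congˡ k (pow≈^ X 6)) (q^-* 6 k)) ⟩
    q^ 3 ⊠ q^ (6 * k)           ≈⟨ q^-+ 3 (6 * k) ⟨
    q^ (3 + 6 * k)              ≈⟨ q^-≡ (lemma k) ⟩
    q^ (Y-exp + Y-exp + Y-exp)  ≈⟨ ≈-trans (q^-+ (Y-exp + Y-exp) Y-exp) (⊠-cong (q^-+ Y-exp Y-exp) ≈-refl) ⟩
    Y k ⊠ Y k ⊠ Y k             ∎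
    where
    Y-exp = suc (2 * k)
    lemma : ∀ k → 3 + 6 * k ≡ suc (2 * k) + suc (2 * k) + suc (2 * k)
    lemma = solve-∀

qPoch-q-q² : ∀ n → qPoch (neg X) (pow X 2) n ≈ poch-odd 1ω n
qPoch-q-q² n = ≈-trans (qPoch≈∏< (neg X) (pow X 2) n) (∏<-cong n λ k _ →
  ≈-trans (one⊞⊟[neg-⊠] X (pow X 2 ^ k)) (⊞-cong ≈-refl (begin
    X ⊠ pow X 2 ^ k          ≈⟨ ⊠-cong (≈-sym (⊠-identityʳ X)) (≈-trans (^-congˡ k (pow≈^ X 2)) (q^-* 2 k)) ⟩
    q^ 1 ⊠ q^ (2 * k)        ≈⟨ q^-+ 1 (2 * k) ⟨
    q^ (suc (2 * k))         ≈⟨ ⊠-identityˡ _ ⟨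
    one ⊠ q^ (suc (2 * k))   ∎)))
  where open ≈-Reasoning

ConstTerm1-poch-odd : ∀ c n → ConstTerm1 (poch-odd c n)
ConstTerm1-poch-odd c n = ConstTerm1-∏< n _ (λ k → ConstTerm1-one⊞q^ (const c) (2 * k))

lhsTerm-factorised : ∀ n → lhsTerm n ≈ q^ (2 * n * n + 2 * n) ⊠ (poch-odd ω n ⊠ poch-odd (ω^ 2) n) ⊠ poch⁻¹ (2 * n)
lhsTerm-factorised n = begin
  (pow X E ⊛ qPoch (neg (pow X 3)) (pow X 6) n) ⊛ inv (qPoch (pow X 2) (pow X 2) (2 * n) ⊛ qPoch (neg X) (pow X 2) n)
    ≈⟨ ⊛-cong (≈-trans (⊛-cong (pow≈^ X E) (qPoch-q³-q⁶ n)) (⊛≈⊠ _ _))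
              (inv-cong (ConstTerm1-resp-≈ (≈-sym denominator) (ConstTerm1-⊠ (ConstTerm1-poch (2 * n)) A₁₀≡1)) denominator) ⟩
  (q^ E ⊠ (A₁ ⊠ W)) ⊛ inv (poch (2 * n) ⊠ A₁)
    ≈⟨ ≈-trans (⊛≈⊠ _ _) (⊠-cong ≈-refl (inv-⊠ (ConstTerm1-poch (2 * n)) A₁₀≡1)) ⟩
  q^ E ⊠ (A₁ ⊠ W) ⊠ (poch⁻¹ (2 * n) ⊠ inv A₁)
    ≈⟨ ⊠-solve 5 (λ e a w p i → (e ⊗ (a ⊗ w)) ⊗ (p ⊗ i) ⊜ ((e ⊗ w) ⊗ p) ⊗ (a ⊗ i)) ≈-refl
                 (q^ E) A₁ W (poch⁻¹ (2 * n)) (inv A₁) ⟩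
  q^ E ⊠ W ⊠ poch⁻¹ (2 * n) ⊠ (A₁ ⊠ inv A₁)
    ≈⟨ ⊠-cong ≈-refl (⊠-inverseʳ A₁₀≡1) ⟩
  q^ E ⊠ W ⊠ poch⁻¹ (2 * n) ⊠ one
    ≈⟨ ⊠-identityʳ _ ⟩
  q^ E ⊠ W ⊠ poch⁻¹ (2 * n) ∎
  where
  open ≈-Reasoning
  E = 2 * n * n + 2 * n
  A₁ = poch-odd 1ω n
  W = poch-odd ω n ⊠ poch-odd (ω^ 2) n
  A₁₀≡1 : ConstTerm1 A₁
  A₁₀≡1 = ConstTerm1-poch-odd 1ω n
  denominator : qPoch (pow X 2) (pow X 2) (2 * n) ⊛ qPoch (neg X) (pow X 2) n ≈ poch (2 * n) ⊠ A₁
  denominator = ≈-trans (⊛-cong (qPoch-q²≈poch (2 * n)) (qPoch-q-q² n)) (⊛≈⊠ _ _)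

ω⊞-factor : ∀ y → const ω ⊞ y ≈ const ω ⊠ (one ⊞ const (ω^ 2) ⊠ y)
ω⊞-factor y = ≈-sym (begin
  const ω ⊠ (one ⊞ const (ω^ 2) ⊠ y)
    ≈⟨ ring-solve 3 (λ c d y → c :* (con (+ 1) :+ d :* y) := c :+ c :* d :* y) ≈-refl (const ω) (const (ω^ 2)) y ⟩
  const ω ⊞ const ω ⊠ const (ω^ 2) ⊠ y
    ≈⟨ ⊞-cong ≈-refl (≈-trans (⊠-cong (const-⊠ ω (ω^ 2)) ≈-refl) (⊠-identityˡ y)) ⟩
  const ω ⊞ y ∎)
  where open ≈-Reasoning

∏<-ω⊞q^odd : ∀ n → ∏< n (λ k → const ω ⊞ q^ (suc (2 * k))) ≈ const (ω^ n) ⊠ poch-odd (ω^ 2) n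
∏<-ω⊞q^odd n = begin
  ∏< n (λ k → const ω ⊞ q^ (suc (2 * k)))                          ≈⟨ ∏<-cong n (λ k _ → ω⊞-factor _) ⟩
  ∏< n (λ k → const ω ⊠ (one ⊞ const (ω^ 2) ⊠ q^ (suc (2 * k))))   ≈⟨ ∏<-⊠ n _ _ ⟩
  ∏< n (λ _ → const ω) ⊠ poch-odd (ω^ 2) n                         ≈⟨ ⊠-cong (∏<-const n (const ω)) ≈-refl ⟩
  const ω ^ n ⊠ poch-odd (ω^ 2) n                                  ≈⟨ ⊠-cong (const-ω-^ n) ≈-refl ⟩
  const (ω^ n) ⊠ poch-odd (ω^ 2) n                                 ∎
  where open ≈-Reasoning

q^2n⊞ωq^odd-low : ∀ n k → k < n →
  q^ (2 * n) ⊞ const ω ⊠ q^ (suc (2 * k)) ≈ q^ (suc (2 * k)) ⊠ (const ω ⊞ q^ (suc (2 * (n ∸ suc k))))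
q^2n⊞ωq^odd-low n k k<n = begin
  q^ (2 * n) ⊞ const ω ⊠ q^ a
    ≈⟨ ⊞-cong (≈-trans (q^-≡ (≤-+-elim (λ n → 2 * n ≡ a + suc (2 * (n ∸ suc k))) k<n exponent)) (q^-+ a _)) ≈-refl ⟩
  q^ a ⊠ q^ b ⊞ const ω ⊠ q^ a
    ≈⟨ ring-solve 3 (λ y z c → y :* z :+ c :* y := y :* (c :+ z)) ≈-refl (q^ a) (q^ b) (const ω) ⟩
  q^ a ⊠ (const ω ⊞ q^ b) ∎
  where
  open ≈-Reasoning
  a = suc (2 * k)
  b = suc (2 * (n ∸ suc k))
  lemma : ∀ k d → 2 * (suc k + d) ≡ suc (2 * k) + suc (2 * d)
  lemma = solve-∀
  exponent : ∀ d → 2 * (suc k + d) ≡ a + suc (2 * (suc k + d ∸ suc k))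
  exponent d = trans (lemma k d) (cong (λ t → a + suc (2 * t)) (sym (ℕP.m+n∸m≡n (suc k) d)))

q^2n⊞ωq^odd-high : ∀ n k → q^ (2 * n) ⊞ const ω ⊠ q^ (suc (2 * (n + k))) ≈ q^ (2 * n) ⊠ (one ⊞ const ω ⊠ q^ (suc (2 * k)))
q^2n⊞ωq^odd-high n k = begin
  q^ (2 * n) ⊞ const ω ⊠ q^ (suc (2 * (n + k)))
    ≈⟨ ⊞-cong ≈-refl (⊠-cong ≈-refl (≈-trans (q^-≡ (lemma n k)) (q^-+ (2 * n) (suc (2 * k))))) ⟩
  q^ (2 * n) ⊞ const ω ⊠ (q^ (2 * n) ⊠ q^ (suc (2 * k)))
    ≈⟨ ring-solve 3 (λ a c y → a :+ c :* (a :* y) := a :* (con (+ 1) :+ c :* y)) ≈-refl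
                    (q^ (2 * n)) (const ω) (q^ (suc (2 * k))) ⟩
  q^ (2 * n) ⊠ (one ⊞ const ω ⊠ q^ (suc (2 * k))) ∎
  where
  open ≈-Reasoning
  lemma : ∀ n k → suc (2 * (n + k)) ≡ 2 * n + suc (2 * k)
  lemma = solve-∀

-- The first n factors are q^{2k+1} (ω + q^{2(n-1-k)+1}), the last n are q^{2n} (1 + ω q^{2k+1}).
∏<-q^2n⊞ωq^odd : ∀ n → ∏< (2 * n) (λ k → q^ (2 * n) ⊞ const ω ⊠ q^ (suc (2 * k)))
                     ≈ const (ω^ n) ⊠ q^ (3 * n * n) ⊠ (poch-odd ω n ⊠ poch-odd (ω^ 2) n)
∏<-q^2n⊞ωq^odd n = begin
  ∏< (2 * n) F
    ≈⟨ coeffwise (λ N → cong (λ t → ∏< t F N) (2n≡n+n n)) ⟩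
  ∏< (n + n) F
    ≈⟨ ∏<-split n n F ⟩
  ∏< n F ⊠ ∏< n (λ k → F (n + k))
    ≈⟨ ⊠-cong (≈-trans (∏<-cong n (q^2n⊞ωq^odd-low n)) (∏<-⊠ n _ _))
              (≈-trans (∏<-cong n (λ k _ → q^2n⊞ωq^odd-high n k)) (∏<-⊠ n _ _)) ⟩
  ∏< n (λ k → q^ (suc (2 * k))) ⊠ ∏< n (λ k → const ω ⊞ q^ (suc (2 * (n ∸ suc k))))
    ⊠ (∏< n (λ _ → q^ (2 * n)) ⊠ poch-odd ω n)
    ≈⟨ ⊠-cong (⊠-cong (∏<-odd-powers n) (≈-trans (≈-sym (∏<-reverse n _)) (∏<-ω⊞q^odd n)))
              (⊠-cong (≈-trans (∏<-const n (q^ (2 * n))) (q^-* (2 * n) n)) ≈-refl) ⟩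
  q^ (n * n) ⊠ (const (ω^ n) ⊠ poch-odd (ω^ 2) n) ⊠ (q^ (2 * n * n) ⊠ poch-odd ω n)
    ≈⟨ ⊠-solve 5 (λ a c P b Q → (a ⊗ (c ⊗ P)) ⊗ (b ⊗ Q) ⊜ (c ⊗ (a ⊗ b)) ⊗ (Q ⊗ P)) ≈-refl
                 (q^ (n * n)) (const (ω^ n)) (poch-odd (ω^ 2) n) (q^ (2 * n * n)) (poch-odd ω n) ⟩
  const (ω^ n) ⊠ (q^ (n * n) ⊠ q^ (2 * n * n)) ⊠ (poch-odd ω n ⊠ poch-odd (ω^ 2) n)
    ≈⟨ ⊠-cong (⊠-cong ≈-refl (≈-trans (≈-sym (q^-+ (n * n) (2 * n * n))) (q^-≡ (3n² n)))) ≈-refl ⟩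
  const (ω^ n) ⊠ q^ (3 * n * n) ⊠ (poch-odd ω n ⊠ poch-odd (ω^ 2) n) ∎
  where
  open ≈-Reasoning
  F : ℕ → PS
  F k = q^ (2 * n) ⊞ const ω ⊠ q^ (suc (2 * k))
  2n≡n+n : ∀ n → 2 * n ≡ n + n
  2n≡n+n = solve-∀
  3n² : ∀ n → n * n + 2 * n * n ≡ 3 * n * n
  3n² = solve-∀

lhsSummand : ℕ → ℕ → PS
lhsSummand n i = const (ω^ (2 * n + i)) ⊠ q^ (2 * n * n + 2 * n + (i * i + 2 * n * (2 * n ∸ i)))
                 ⊠ (poch⁻¹ i ⊠ poch⁻¹ (2 * n ∸ i))

const-ω^-⊠ : ∀ a b → const (ω^ a) ⊠ const (ω^ b) ≈ const (ω^ (a + b))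
const-ω^-⊠ a b = ≈-trans (const-⊠ (ω^ a) (ω^ b)) (const-≡ (sym (ω^-+ a b)))

binomialTerm→lhsSummand : ∀ n i → i ≤ 2 * n →
  q^ (2 * n * n + 2 * n) ⊠ const (ω^ (2 * n)) ⊠ poch⁻¹ (2 * n) ⊠ binomialTerm (2 * n) (q^ (2 * n)) (const ω) i ≈ lhsSummand n i
binomialTerm→lhsSummand n i i≤2n = begin
  q^ E ⊠ c ⊠ P ⊠ (q^ (i * i) ⊠ const ω ^ i ⊠ q^ (2 * n) ^ (2 * n ∸ i) ⊠ G)
    ≈⟨ ⊠-cong ≈-refl (⊠-cong (⊠-cong (⊠-cong ≈-refl (const-ω-^ i)) (q^-* (2 * n) (2 * n ∸ i))) ≈-refl) ⟩
  q^ E ⊠ c ⊠ P ⊠ (q^ (i * i) ⊠ const (ω^ i) ⊠ q^ D ⊠ G)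
    ≈⟨ ⊠-solve 7 (λ e c P s w d G → ((e ⊗ c) ⊗ P) ⊗ (((s ⊗ w) ⊗ d) ⊗ G) ⊜ ((c ⊗ w) ⊗ (e ⊗ (s ⊗ d))) ⊗ (G ⊗ P)) ≈-refl
                 (q^ E) c P (q^ (i * i)) (const (ω^ i)) (q^ D) G ⟩
  c ⊠ const (ω^ i) ⊠ (q^ E ⊠ (q^ (i * i) ⊠ q^ D)) ⊠ (G ⊠ P)
    ≈⟨ ⊠-cong (⊠-cong (const-ω^-⊠ (2 * n) i) (≈-trans (⊠-cong ≈-refl (≈-sym (q^-+ (i * i) D))) (≈-sym (q^-+ E (i * i + D)))))
              (qbinom-poch⁻¹ (2 * n) i i≤2n) ⟩
  lhsSummand n i ∎
  where
  open ≈-Reasoning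
  E = 2 * n * n + 2 * n
  D = 2 * n * (2 * n ∸ i)
  c = const (ω^ (2 * n))
  P = poch⁻¹ (2 * n)
  G = qbinom (2 * n) i

q^3n²-⊠-lhsTerm : ∀ n → q^ (3 * n * n) ⊠ lhsTerm n ≈ Σ< (suc (2 * n)) (lhsSummand n)
q^3n²-⊠-lhsTerm n = begin
  q^ (3 * n * n) ⊠ lhsTerm n
    ≈⟨ ⊠-cong ≈-refl (lhsTerm-factorised n) ⟩
  q^ (3 * n * n) ⊠ (q^ E ⊠ W ⊠ P)
    ≈⟨ ⊠-solve 4 (λ a e W P → a ⊗ ((e ⊗ W) ⊗ P) ⊜ id ⊗ ((a ⊗ W) ⊗ (e ⊗ P))) ≈-refl (q^ (3 * n * n)) (q^ E) W P ⟩
  one ⊠ (q^ (3 * n * n) ⊠ W ⊠ (q^ E ⊠ P))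
    ≈⟨ ⊠-cong ω³ⁿ≈1 ≈-refl ⟨
  c ⊠ const (ω^ n) ⊠ (q^ (3 * n * n) ⊠ W ⊠ (q^ E ⊠ P))
    ≈⟨ ⊠-solve 6 (λ c d a W e P → (c ⊗ d) ⊗ ((a ⊗ W) ⊗ (e ⊗ P)) ⊜ ((e ⊗ c) ⊗ P) ⊗ ((d ⊗ a) ⊗ W)) ≈-refl
                 c (const (ω^ n)) (q^ (3 * n * n)) W (q^ E) P ⟩
  q^ E ⊠ c ⊠ P ⊠ (const (ω^ n) ⊠ q^ (3 * n * n) ⊠ W)
    ≈⟨ ⊠-cong ≈-refl (≈-trans (≈-sym (∏<-q^2n⊞ωq^odd n)) (q-binomial (q^ (2 * n)) (const ω) (2 * n))) ⟩
  q^ E ⊠ c ⊠ P ⊠ Σ< (suc (2 * n)) (binomialTerm (2 * n) (q^ (2 * n)) (const ω))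
    ≈⟨ ⊠-distribˡ-Σ< (suc (2 * n)) _ _ ⟩
  Σ< (suc (2 * n)) (λ i → q^ E ⊠ c ⊠ P ⊠ binomialTerm (2 * n) (q^ (2 * n)) (const ω) i)
    ≈⟨ Σ<-cong (suc (2 * n)) (λ i i<1+2n → binomialTerm→lhsSummand n i (ℕP.≤-pred i<1+2n)) ⟩
  Σ< (suc (2 * n)) (lhsSummand n) ∎
  where
  open ≈-Reasoning
  E = 2 * n * n + 2 * n
  W = poch-odd ω n ⊠ poch-odd (ω^ 2) n
  P = poch⁻¹ (2 * n)
  c = const (ω^ (2 * n))
  ω³ⁿ≈1 : c ⊠ const (ω^ n) ≈ one
  ω³ⁿ≈1 = ≈-trans (const-ω^-⊠ (2 * n) n) (const-≡ (trans (cong ω^_ (lemma n)) (ω^-*3 n)))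
    where
    lemma : ∀ n → 2 * n + n ≡ n * 3
    lemma = solve-∀

Σ<-fold : ∀ n f → Σ< (suc (2 * n)) f ≈ f n ⊞ Σ< n (λ j → f (n + suc j) ⊞ f (n ∸ suc j))
Σ<-fold n f = begin
  Σ< (suc (2 * n)) f
    ≈⟨ coeffwise (λ N → cong (λ t → Σ< t f N) (lemma n)) ⟩
  Σ< (suc n + n) f
    ≈⟨ Σ<-split (suc n) n f ⟩
  Σ< (suc n) f ⊞ Σ< n (λ b → f (suc n + b))
    ≈⟨ ⊞-cong (≈-trans (Σ<-last n f) (⊞-cong (Σ<-reverse n f) ≈-refl))
              (Σ<-cong n (λ b _ → coeffwise λ N → cong (λ t → f t N) (sym (ℕP.+-suc n b)))) ⟩
  Σ< n (λ j → f (n ∸ suc j)) ⊞ f n ⊞ Σ< n (λ j → f (n + suc j))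
    ≈⟨ ring-solve 3 (λ a b c → a :+ b :+ c := b :+ (c :+ a)) ≈-refl
                    (Σ< n (λ j → f (n ∸ suc j))) (f n) (Σ< n (λ j → f (n + suc j))) ⟩
  f n ⊞ (Σ< n (λ j → f (n + suc j)) ⊞ Σ< n (λ j → f (n ∸ suc j)))
    ≈⟨ ⊞-cong ≈-refl (Σ<-⊞ n _ _) ⟨
  f n ⊞ Σ< n (λ j → f (n + suc j) ⊞ f (n ∸ suc j)) ∎
  where
  open ≈-Reasoning
  lemma : ∀ n → suc (2 * n) ≡ suc n + n
  lemma = solve-∀

pairWeight : ℕ → PS
pairWeight j = const (ω^± j) ⊠ q^ (3 * j * j + 2 * j)

lhsPairTerm : ℕ → ℕ → PS
lhsPairTerm j m = pairWeight j ⊠ doubleTerm (2 * j) m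

ωq^poch⁻¹-cong : ∀ {a a′ e e′ b b′ c c′} → ω^ a ≡ ω^ a′ → e ≡ e′ → b ≡ b′ → c ≡ c′ →
  const (ω^ a) ⊠ q^ e ⊠ (poch⁻¹ b ⊠ poch⁻¹ c) ≈ const (ω^ a′) ⊠ q^ e′ ⊠ (poch⁻¹ b′ ⊠ poch⁻¹ c′)
ωq^poch⁻¹-cong ω^a≡ω^a′ refl refl refl = ⊠-cong (⊠-cong (const-≡ ω^a≡ω^a′) ≈-refl) ≈-refl

-- The exponent of q in lhsSummand n (n ± J), written in terms of J and m = n - J.
pairExponent : ℕ → ℕ → ℕ
pairExponent J m = 3 * (J + m) * (J + m) + (3 * J * J + 2 * J + 2 * (m * m + m + 2 * J * m))

lhsSummand-high : ∀ J m →
  lhsSummand (J + m) (J + m + J) ≈ const (ω^ J) ⊠ q^ (pairExponent J m) ⊠ (poch⁻¹ (m + 2 * J) ⊠ poch⁻¹ m)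
lhsSummand-high J m = ωq^poch⁻¹-cong ω-exponent exponent index coindex
  where
  n = J + m
  coindex : 2 * n ∸ (n + J) ≡ m
  coindex = trans (cong (_∸ (n + J)) (lemma J m)) (ℕP.m+n∸m≡n (n + J) m)
    where
    lemma : ∀ J m → 2 * (J + m) ≡ J + m + J + m
    lemma = solve-∀
  index : n + J ≡ m + 2 * J
  index = lemma J m
    where
    lemma : ∀ J m → J + m + J ≡ m + 2 * J
    lemma = solve-∀
  ω-exponent : ω^ (2 * n + (n + J)) ≡ ω^ J
  ω-exponent = trans (cong ω^_ (lemma J m)) (ω^-+*3 J n)
    where
    lemma : ∀ J m → 2 * (J + m) + (J + m + J) ≡ J + (J + m) * 3
    lemma = solve-∀
  exponent : 2 * n * n + 2 * n + ((n + J) * (n + J) + 2 * n * (2 * n ∸ (n + J))) ≡ pairExponent J m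
  exponent = trans (cong (λ t → 2 * n * n + 2 * n + ((n + J) * (n + J) + 2 * n * t)) coindex) (lemma J m)
    where
    lemma : ∀ J m → 2 * (J + m) * (J + m) + 2 * (J + m) + ((J + m + J) * (J + m + J) + 2 * (J + m) * m)
                  ≡ 3 * (J + m) * (J + m) + (3 * J * J + 2 * J + 2 * (m * m + m + 2 * J * m))
    lemma = solve-∀

lhsSummand-low : ∀ J m →
  lhsSummand (J + m) (J + m ∸ J) ≈ const (ω^ (2 * J)) ⊠ q^ (pairExponent J m) ⊠ (poch⁻¹ m ⊠ poch⁻¹ (m + 2 * J))
lhsSummand-low J m = ωq^poch⁻¹-cong ω-exponent exponent (ℕP.m+n∸m≡n J m) coindex
  where
  n = J + m
  coindex : 2 * n ∸ (n ∸ J) ≡ m + 2 * J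
  coindex = trans (cong (λ t → 2 * n ∸ t) (ℕP.m+n∸m≡n J m))
                  (trans (cong (_∸ m) (lemma J m)) (ℕP.m+n∸m≡n m (m + 2 * J)))
    where
    lemma : ∀ J m → 2 * (J + m) ≡ m + (m + 2 * J)
    lemma = solve-∀
  ω-exponent : ω^ (2 * n + (n ∸ J)) ≡ ω^ (2 * J)
  ω-exponent = trans (cong (λ t → ω^ (2 * n + t)) (ℕP.m+n∸m≡n J m)) (trans (cong ω^_ (lemma J m)) (ω^-+*3 (2 * J) m))
    where
    lemma : ∀ J m → 2 * (J + m) + m ≡ 2 * J + m * 3
    lemma = solve-∀
  exponent : 2 * n * n + 2 * n + ((n ∸ J) * (n ∸ J) + 2 * n * (2 * n ∸ (n ∸ J))) ≡ pairExponent J m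
  exponent = trans (cong₂ (λ s t → 2 * n * n + 2 * n + (s * s + 2 * n * t)) (ℕP.m+n∸m≡n J m) coindex) (lemma J m)
    where
    lemma : ∀ J m → 2 * (J + m) * (J + m) + 2 * (J + m) + (m * m + 2 * (J + m) * (m + 2 * J))
                  ≡ 3 * (J + m) * (J + m) + (3 * J * J + 2 * J + 2 * (m * m + m + 2 * J * m))
    lemma = solve-∀

pairExponent-split : ∀ c J m → const c ⊠ q^ (pairExponent J m) ⊠ (poch⁻¹ m ⊠ poch⁻¹ (m + 2 * J))
                    ≈ q^ (3 * (J + m) * (J + m)) ⊠ (const c ⊠ q^ (3 * J * J + 2 * J) ⊠ doubleTerm (2 * J) m)
pairExponent-split c J m = begin
  const c ⊠ q^ (A + (B + C)) ⊠ R
    ≈⟨ ⊠-cong (⊠-cong ≈-refl (≈-trans (q^-+ A (B + C)) (⊠-cong ≈-refl (q^-+ B C)))) ≈-refl ⟩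
  const c ⊠ (q^ A ⊠ (q^ B ⊠ q^ C)) ⊠ R
    ≈⟨ ⊠-solve 5 (λ c a b d R → (c ⊗ (a ⊗ (b ⊗ d))) ⊗ R ⊜ a ⊗ ((c ⊗ b) ⊗ (d ⊗ R))) ≈-refl (const c) (q^ A) (q^ B) (q^ C) R ⟩
  q^ A ⊠ (const c ⊠ q^ B ⊠ doubleTerm (2 * J) m) ∎
  where
  open ≈-Reasoning
  A = 3 * (J + m) * (J + m)
  B = 3 * J * J + 2 * J
  C = 2 * (m * m + m + 2 * J * m)
  R = poch⁻¹ m ⊠ poch⁻¹ (m + 2 * J)

lhsSummand-pair : ∀ J m →
  lhsSummand (J + m) (J + m + J) ⊞ lhsSummand (J + m) (J + m ∸ J)
    ≈ q^ (3 * (J + m) * (J + m)) ⊠ (const (ω^ J +ω ω^ (2 * J)) ⊠ q^ (3 * J * J + 2 * J) ⊠ doubleTerm (2 * J) m)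
lhsSummand-pair J m = begin
  lhsSummand (J + m) (J + m + J) ⊞ lhsSummand (J + m) (J + m ∸ J)
    ≈⟨ ⊞-cong (lhsSummand-high J m) (lhsSummand-low J m) ⟩
  const (ω^ J) ⊠ q^ E ⊠ (poch⁻¹ (m + 2 * J) ⊠ poch⁻¹ m) ⊞ const (ω^ (2 * J)) ⊠ q^ E ⊠ (poch⁻¹ m ⊠ poch⁻¹ (m + 2 * J))
    ≈⟨ ring-solve 5 (λ a b e x y → a :* e :* (y :* x) :+ b :* e :* (x :* y) := (a :+ b) :* e :* (x :* y)) ≈-refl
                    (const (ω^ J)) (const (ω^ (2 * J))) (q^ E) (poch⁻¹ m) (poch⁻¹ (m + 2 * J)) ⟩
  (const (ω^ J) ⊞ const (ω^ (2 * J))) ⊠ q^ E ⊠ (poch⁻¹ m ⊠ poch⁻¹ (m + 2 * J))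
    ≈⟨ ⊠-cong (⊠-cong (const-⊞ (ω^ J) (ω^ (2 * J))) ≈-refl) ≈-refl ⟩
  const (ω^ J +ω ω^ (2 * J)) ⊠ q^ E ⊠ (poch⁻¹ m ⊠ poch⁻¹ (m + 2 * J))
    ≈⟨ pairExponent-split (ω^ J +ω ω^ (2 * J)) J m ⟩
  q^ (3 * (J + m) * (J + m)) ⊠ (const (ω^ J +ω ω^ (2 * J)) ⊠ q^ (3 * J * J + 2 * J) ⊠ doubleTerm (2 * J) m) ∎
  where
  open ≈-Reasoning
  E = pairExponent J m

lhsTerm-expansion : ∀ n → lhsTerm n ≈ Σ< (suc n) (λ j → lhsPairTerm j (n ∸ j))
lhsTerm-expansion n = q^-⊠-cancel (3 * n * n) (begin
  Q ⊠ lhsTerm n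
    ≈⟨ q^3n²-⊠-lhsTerm n ⟩
  Σ< (suc (2 * n)) (lhsSummand n)
    ≈⟨ Σ<-fold n (lhsSummand n) ⟩
  lhsSummand n n ⊞ Σ< n (λ j → lhsSummand n (n + suc j) ⊞ lhsSummand n (n ∸ suc j))
    ≈⟨ ⊞-cong (≈-trans (lhsSummand-low 0 n) (pairExponent-split 1ω 0 n)) (Σ<-cong n pair) ⟩
  Q ⊠ lhsPairTerm 0 n ⊞ Σ< n (λ j → Q ⊠ lhsPairTerm (suc j) (n ∸ suc j))
    ≈⟨ ⊞-cong ≈-refl (⊠-distribˡ-Σ< n Q (λ j → lhsPairTerm (suc j) (n ∸ suc j))) ⟨
  Q ⊠ lhsPairTerm 0 n ⊞ Q ⊠ Σ< n (λ j → lhsPairTerm (suc j) (n ∸ suc j))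
    ≈⟨ ⊠-distribˡ-⊞ Q _ _ ⟨
  Q ⊠ (lhsPairTerm 0 n ⊞ Σ< n (λ j → lhsPairTerm (suc j) (n ∸ suc j)))
    ≈⟨ ⊠-cong ≈-refl (Σ<-head n (λ j → lhsPairTerm j (n ∸ j))) ⟨
  Q ⊠ Σ< (suc n) (λ j → lhsPairTerm j (n ∸ j)) ∎)
  where
  open ≈-Reasoning
  Q = q^ (3 * n * n)
  pair : ∀ j → j < n → lhsSummand n (n + suc j) ⊞ lhsSummand n (n ∸ suc j) ≈ Q ⊠ lhsPairTerm (suc j) (n ∸ suc j)
  pair j j<n = ≤-+-elim (λ n → lhsSummand n (n + suc j) ⊞ lhsSummand n (n ∸ suc j)
                             ≈ q^ (3 * n * n) ⊠ lhsPairTerm (suc j) (n ∸ suc j)) j<n λ m →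
    ≈-trans (lhsSummand-pair (suc j) m)
            (⊠-cong ≈-refl (coeffwise λ N → cong (λ t → lhsPairTerm (suc j) t N) (sym (ℕP.m+n∸m≡n (suc j) m))))

-- The right-hand side

sumPS-map-applyUpTo : ∀ (F : ℤ → PS) (h : ℕ → ℤ) (g : ℕ → ℕ) L →
  sumPS (List.map F (List.map h (List.applyUpTo g L))) ≈ Σ< L (λ k → F (h (g k)))
sumPS-map-applyUpTo F h g zero    = coeffwise 𝟘-coeff
sumPS-map-applyUpTo F h g (suc L) = coeffwise λ N →
  trans (cong (F (h (g 0)) N +ω_) (coeff (sumPS-map-applyUpTo F h (λ k → g (suc k)) L) N))
        (sym (sumTo-head (λ k → F (h (g k)) N) L))

rhsSummand : ℕ → ℤ → PS
rhsSummand n j = const (expOmega j) ⊠ q^ (n * suc n ∸ ℤ.∣ j ∣ * ℤ.∣ j ∣)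

innerSummand : ℕ → ℕ → PS
innerSummand n j = const (ω^± j) ⊠ q^ (n * suc n ∸ j * j)

innerTerm-expansion : ∀ n → innerTerm n ≈ Σ< (suc (n / 2)) (innerSummand n)
innerTerm-expansion n = begin
  innerTerm n
    ≈⟨ sumPS-map-applyUpTo (λ j → const (expOmega j) ⊛ pow X (n * suc n ∸ ℤ.∣ j ∣ * ℤ.∣ j ∣)) (λ k → + k ℤ.- + m) (λ k → k) (suc (2 * m)) ⟩
  Σ< (suc (2 * m)) (λ k → const (expOmega (+ k ℤ.- + m)) ⊛ pow X (n * suc n ∸ ℤ.∣ + k ℤ.- + m ∣ * ℤ.∣ + k ℤ.- + m ∣))
    ≈⟨ Σ<-cong (suc (2 * m)) (λ k _ → ≈-trans (⊛-cong (≈-refl {const (expOmega (+ k ℤ.- + m))}) (pow≈^ X (n * suc n ∸ ℤ.∣ + k ℤ.- + m ∣ * ℤ.∣ + k ℤ.- + m ∣))) (⊛≈⊠ _ _)) ⟩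
  Σ< (suc (2 * m)) (λ k → rhsSummand n (+ k ℤ.- + m))
    ≈⟨ Σ<-fold m _ ⟩
  rhsSummand n (+ m ℤ.- + m) ⊞ Σ< m (λ j → rhsSummand n (+ (m + suc j) ℤ.- + m) ⊞ rhsSummand n (+ (m ∸ suc j) ℤ.- + m))
    ≈⟨ ⊞-cong (rhsSummand-≡ (trans (ℤP.[+m]-[+n]≡m⊖n m m) (ℤP.n⊖n≡0 m)))
              (Σ<-cong m (λ j j<m → ≈-trans (⊞-cong (rhsSummand-≡ (positive j)) (rhsSummand-≡ (negative j j<m))) (pair j))) ⟩
  innerSummand n 0 ⊞ Σ< m (λ j → innerSummand n (suc j))
    ≈⟨ Σ<-head m (innerSummand n) ⟨
  Σ< (suc m) (innerSummand n) ∎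
  where
  open ≈-Reasoning
  m = n / 2
  rhsSummand-≡ : ∀ {i j} → i ≡ j → rhsSummand n i ≈ rhsSummand n j
  rhsSummand-≡ refl = ≈-refl
  positive : ∀ j → + (m + suc j) ℤ.- + m ≡ + suc j
  positive j = trans (ℤP.[+m]-[+n]≡m⊖n (m + suc j) m)
                     (trans (ℤP.≤-⊖ (ℕP.m≤m+n m (suc j))) (cong +_ (ℕP.m+n∸m≡n m (suc j))))
  negative : ∀ j → j < m → + (m ∸ suc j) ℤ.- + m ≡ -[1+ j ]
  negative j j<m = trans (ℤP.[+m]-[+n]≡m⊖n (m ∸ suc j) m)
                   (trans (ℤP.⊖-swap (m ∸ suc j) m)
                   (cong ℤ.-_ (trans (ℤP.≤-⊖ (ℕP.m∸n≤m m (suc j))) (cong +_ (ℕP.m∸[m∸n]≡n j<m)))))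
  pair : ∀ j → rhsSummand n (+ suc j) ⊞ rhsSummand n -[1+ j ] ≈ innerSummand n (suc j)
  pair j = begin
    const (expOmega (+ suc j)) ⊠ Q ⊞ const (expOmega -[1+ j ]) ⊠ Q
      ≈⟨ ⊠-distribʳ-⊞ Q _ _ ⟨
    (const (expOmega (+ suc j)) ⊞ const (expOmega -[1+ j ])) ⊠ Q
      ≈⟨ ⊠-cong (≈-trans (const-⊞ _ _) (const-≡ (cong₂ _+ω_ (expOmega-+ (suc j)) (expOmega-neg j)))) ≈-refl ⟩
    innerSummand n (suc j) ∎
    where
    Q = q^ (n * suc n ∸ suc j * suc j)

rhsPairTerm : ℕ → ℕ → PS
rhsPairTerm j r = pairWeight j ⊠ thetaTerm (2 * j) r

rhsTerm-expansion : ∀ n → rhsTerm n ≈ Σ< (suc (n / 2)) (λ j → rhsPairTerm j (n ∸ 2 * j))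
rhsTerm-expansion n = begin
  pow (neg one) n ⊛ innerTerm n
    ≈⟨ ≈-trans (⊛-cong (≈-trans (pow≈^ (neg one) n) (^-congˡ n (neg≈⊟ one))) (innerTerm-expansion n)) (⊛≈⊠ _ _) ⟩
  sgn n ⊠ Σ< (suc (n / 2)) (innerSummand n)
    ≈⟨ ⊠-distribˡ-Σ< (suc (n / 2)) (sgn n) (innerSummand n) ⟩
  Σ< (suc (n / 2)) (λ j → sgn n ⊠ innerSummand n j)
    ≈⟨ Σ<-cong (suc (n / 2)) (λ j j≤n/2 → term j (≤/⇒*≤ 2 (ℕP.≤-pred j≤n/2))) ⟩
  Σ< (suc (n / 2)) (λ j → rhsPairTerm j (n ∸ 2 * j)) ∎
  where
  open ≈-Reasoning
  term : ∀ j → 2 * j ≤ n → sgn n ⊠ innerSummand n j ≈ rhsPairTerm j (n ∸ 2 * j)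
  term j 2j≤n = ≤-+-elim (λ n → sgn n ⊠ innerSummand n j ≈ rhsPairTerm j (n ∸ 2 * j)) 2j≤n λ r → begin
    sgn (2 * j + r) ⊠ (const (ω^± j) ⊠ q^ ((2 * j + r) * suc (2 * j + r) ∸ j * j))
      ≈⟨ ⊠-cong (≈-trans (sgn-+ (2 * j) r) (≈-trans (⊠-cong (sgn-2* j) ≈-refl) (⊠-identityˡ (sgn r))))
                (⊠-cong ≈-refl (≈-trans (q^-≡ (exponent r)) (q^-+ (3 * j * j + 2 * j) _))) ⟩
    sgn r ⊠ (const (ω^± j) ⊠ (q^ (3 * j * j + 2 * j) ⊠ q^ (r * r + r + 2 * (2 * j) * r)))
      ≈⟨ ⊠-solve 4 (λ s c a b → s ⊗ (c ⊗ (a ⊗ b)) ⊜ (c ⊗ a) ⊗ (s ⊗ b)) ≈-refl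
                   (sgn r) (const (ω^± j)) (q^ (3 * j * j + 2 * j)) (q^ (r * r + r + 2 * (2 * j) * r)) ⟩
    rhsPairTerm j r
      ≈⟨ coeffwise (λ N → cong (λ t → rhsPairTerm j t N) (sym (ℕP.m+n∸m≡n (2 * j) r))) ⟩
    rhsPairTerm j (2 * j + r ∸ 2 * j) ∎
    where
    lemma : ∀ j r → (2 * j + r) * suc (2 * j + r) ≡ j * j + (3 * j * j + 2 * j + (r * r + r + 2 * (2 * j) * r))
    lemma = solve-∀
    exponent : ∀ r → (2 * j + r) * suc (2 * j + r) ∸ j * j ≡ 3 * j * j + 2 * j + (r * r + r + 2 * (2 * j) * r)
    exponent r = trans (cong (_∸ j * j) (lemma j r)) (ℕP.m+n∸m≡n (j * j) _)

q^∣-pairWeight : ∀ j → q^ (3 * j * j + 2 * j) ∣ pairWeight j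
q^∣-pairWeight j = q^∣-⊠ʳ (const (ω^± j)) (q^∣q^ _)

2j≤3jj+2j : ∀ j → 2 * j ≤ 3 * j * j + 2 * j
2j≤3jj+2j j = ℕP.m≤n+m (2 * j) (3 * j * j)

lhsPairTerm-ord : ∀ j m → q^ (j + m) ∣ lhsPairTerm j m
lhsPairTerm-ord j m = q^∣-⊠ j m (q^∣-mono (ℕP.≤-trans (ℕP.m≤m+n j (j + 0)) (2j≤3jj+2j j)) (q^∣-pairWeight j))
                               (doubleTerm-summable (2 * j) m)

rhsPairTerm-ord : ∀ j r → q^ (2 * j + r) ∣ rhsPairTerm j r
rhsPairTerm-ord j r = q^∣-⊠ (2 * j) r (q^∣-mono (2j≤3jj+2j j) (q^∣-pairWeight j)) (thetaTerm-summable (2 * j) r)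

lhsTerm-summable : Summable lhsTerm
lhsTerm-summable n = q^∣-resp-≈ (≈-sym (lhsTerm-expansion n)) (q^∣-Σ< (suc n) _ λ j j≤n →
  subst (λ e → q^ e ∣ lhsPairTerm j (n ∸ j)) (ℕP.m+[n∸m]≡n (ℕP.≤-pred j≤n)) (lhsPairTerm-ord j (n ∸ j)))

rhsTerm-summable : Summable rhsTerm
rhsTerm-summable n = q^∣-resp-≈ (≈-sym (rhsTerm-expansion n)) (q^∣-Σ< (suc (n / 2)) _ λ j j≤n/2 →
  subst (λ e → q^ e ∣ rhsPairTerm j (n ∸ 2 * j)) (ℕP.m+[n∸m]≡n (≤/⇒*≤ 2 (ℕP.≤-pred j≤n/2))) (rhsPairTerm-ord j (n ∸ 2 * j)))

Σ<-lhsTerm : ∀ K → Σ< K lhsTerm ≈[ K ] Σ< K (λ j → Σ< K (lhsPairTerm j))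
Σ<-lhsTerm K = begin
  Σ< K lhsTerm                                          ≈⟨ ≈⇒≈[] K (Σ<-cong K (λ n _ → lhsTerm-expansion n)) ⟩
  Σ< K (λ n → Σ< (suc n) (λ j → lhsPairTerm j (n ∸ j))) ≈⟨ Σ<-Σ<-antidiagonal K lhsPairTerm lhsPairTerm-ord ⟨
  Σ< K (λ j → Σ< K (lhsPairTerm j))                     ∎
  where open ≈[]-Reasoning K

Σ<-rhsTerm : ∀ K → Σ< K rhsTerm ≈[ K ] Σ< K (λ j → Σ< K (rhsPairTerm j))
Σ<-rhsTerm K = begin
  Σ< K rhsTerm                                                         ≈⟨ ≈⇒≈[] K (Σ<-cong K (λ n _ → rhsTerm-expansion n)) ⟩
  Σ< K (λ n → Σ< (suc (n / 2)) (λ j → rhsPairTerm j (n ∸ 2 * j)))      ≈⟨ Σ<-Σ<-diagonal 2 K rhsPairTerm rhsPairTerm-ord ⟨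
  Σ< K (λ j → Σ< K (rhsPairTerm j))                                    ∎
  where open ≈[]-Reasoning K

poch∞-⊠-Σ<-lhsPairTerm : ∀ K j → poch∞ ⊠ Σ< K (lhsPairTerm j) ≈[ K ] Σ< K (rhsPairTerm j)
poch∞-⊠-Σ<-lhsPairTerm K j = begin
  poch∞ ⊠ Σ< K (lhsPairTerm j)
    ≈⟨ ≈⇒≈[] K (⊠-cong ≈-refl (⊠-distribˡ-Σ< K (pairWeight j) (doubleTerm (2 * j)))) ⟨
  poch∞ ⊠ (pairWeight j ⊠ Σ< K (doubleTerm (2 * j)))
    ≈⟨ ≈⇒≈[] K (⊠-solve 3 (λ P w S → P ⊗ (w ⊗ S) ⊜ w ⊗ (P ⊗ S)) ≈-refl poch∞ (pairWeight j) _) ⟩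
  pairWeight j ⊠ (poch∞ ⊠ Σ< K (doubleTerm (2 * j)))
    ≈⟨ ⊠-cong-≈[] K ≈[]-refl (⊠-cong-≈[] K ≈[]-refl (sumSeries-≈[]-Σ< K _ (doubleTerm-summable (2 * j)))) ⟨
  pairWeight j ⊠ (poch∞ ⊠ sumSeries (doubleTerm (2 * j)))
    ≈⟨ ≈⇒≈[] K (⊠-cong ≈-refl (theta-identity (2 * j))) ⟩
  pairWeight j ⊠ sumSeries (thetaTerm (2 * j))
    ≈⟨ ⊠-cong-≈[] K ≈[]-refl (sumSeries-≈[]-Σ< K _ (thetaTerm-summable (2 * j))) ⟩
  pairWeight j ⊠ Σ< K (thetaTerm (2 * j))
    ≈⟨ ≈⇒≈[] K (⊠-distribˡ-Σ< K (pairWeight j) (thetaTerm (2 * j))) ⟩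
  Σ< K (rhsPairTerm j) ∎
  where open ≈[]-Reasoning K

poch∞-⊠-LHS : poch∞ ⊠ LHS ≈ sumSeries rhsTerm
poch∞-⊠-LHS = ≈[]-all⇒≈ λ K → let open ≈[]-Reasoning K in begin
  poch∞ ⊠ LHS                                       ≈⟨ ⊠-cong-≈[] K ≈[]-refl (sumSeries-≈[]-Σ< K lhsTerm lhsTerm-summable) ⟩
  poch∞ ⊠ Σ< K lhsTerm                              ≈⟨ ⊠-cong-≈[] K ≈[]-refl (Σ<-lhsTerm K) ⟩
  poch∞ ⊠ Σ< K (λ j → Σ< K (lhsPairTerm j))         ≈⟨ ≈⇒≈[] K (⊠-distribˡ-Σ< K poch∞ _) ⟩
  Σ< K (λ j → poch∞ ⊠ Σ< K (lhsPairTerm j))         ≈⟨ Σ<-cong-≈[] K K (λ j _ → poch∞-⊠-Σ<-lhsPairTerm K j) ⟩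
  Σ< K (λ j → Σ< K (rhsPairTerm j))                 ≈⟨ Σ<-rhsTerm K ⟨
  Σ< K rhsTerm                                      ≈⟨ sumSeries-≈[]-Σ< K rhsTerm rhsTerm-summable ⟨
  sumSeries rhsTerm                                 ∎

LHS≈RHS : LHS ≈ RHS
LHS≈RHS = begin
  LHS                                ≈⟨ ⊠-identityˡ LHS ⟨
  one ⊠ LHS                          ≈⟨ ⊠-cong (⊠-inverseˡ {poch∞} refl) ≈-refl ⟨
  inv poch∞ ⊠ poch∞ ⊠ LHS            ≈⟨ ⊠-assoc _ _ _ ⟩
  inv poch∞ ⊠ (poch∞ ⊠ LHS)          ≈⟨ ⊠-cong ≈-refl poch∞-⊠-LHS ⟩
  inv poch∞ ⊠ sumSeries rhsTerm      ≈⟨ ⊛≈⊠ _ _ ⟨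
  RHS                                ∎
  where open ≈-Reasoning

corollary7p4 : (N : ℕ) → LHS N ≡ RHS N
corollary7p4 = coeff LHS≈RHS
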